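{- For all $n \ge 1$, $$|\mathfrak{S}_n(1243,2143,321)| = \binom{n-1}{0} + \binom{n-1}{1} + 2\binom{n-1}{2} + 2\binom{n-1}{3}.$$ Moreover, $$\sum_{n=0}^\infty |\mathfrak{S}_n(1243,2143,321)|\,x^n = 1 + x\frac{1-2x+3x^2}{(1-x)^4}.$$
   Context: $\mathfrak{S}_n(R)$ is the set of permutations of $\{1,\dots,n\}$ that contain no subsequence with the same relative order as any pattern in $R$. -}

module Defs where

open import Data.Nat using (ℕ; zero; suc; _<_; _∸_)
open import Data.Integer using (ℤ; _+_; _*_; -_; +_)
open import Data.Fin using (Fin; cast)
open import Data.List using (List; []; _∷_; length; lookup; applyUpTo)
open import Data.List.Relation.Binary.Sublist.Propositional using (_⊆_)
open import Data.List.Relation.Binary.Permutation.Propositional using (_↭_)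
open import Data.List.Relation.Unary.All using (All)
open import Data.List.Relation.Unary.Unique.Propositional using (Unique)
open import Data.List.Membership.Propositional using (_∈_)
open import Data.Product using (Σ; ∃; _×_)
open import Function.Bundles using (_⇔_)
open import Relation.Nullary using (¬_)
open import Relation.Binary.PropositionalEquality using (_≡_)

-- A word / permutation in one-line notation is a list of naturals.
-- Permutations of {1,…,n}: lists that are a rearrangement of [1,…,n].
IsPerm : ℕ → List ℕ → Set
IsPerm n w = w ↭ applyUpTo suc n

SameOrder : List ℕ → List ℕ → Set
SameOrder s p =
  Σ (length s ≡ length p) λ eq →
    (i j : Fin (length s)) →
      (lookup s i < lookup s j) ⇔ (lookup p (cast eq i) < lookup p (cast eq j))

Contains : List ℕ → List ℕ → Set
Contains p w = ∃ λ s → (s ⊆ w) × SameOrder s p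

Avoids : List (List ℕ) → List ℕ → Set
Avoids R w = All (λ p → ¬ Contains p w) R

InS : ℕ → List (List ℕ) → List ℕ → Set
InS n R w = IsPerm n w × Avoids R w

-- L is a duplicate-free list enumerating exactly 𝔖_n(R); so |𝔖_n(R)| = length L.
Enumerates : ℕ → List (List ℕ) → List (List ℕ) → Set
Enumerates n R L = Unique L × ((w : List ℕ) → (w ∈ L) ⇔ InS n R w)

R₀ : List (List ℕ)
R₀ = (1 ∷ 2 ∷ 4 ∷ 3 ∷ []) ∷ (2 ∷ 1 ∷ 4 ∷ 3 ∷ []) ∷ (3 ∷ 2 ∷ 1 ∷ []) ∷ []

-- Formal power series over ℤ, as coefficient sequences.
Series : Set
Series = ℕ → ℤ

sumTo : ℕ → (ℕ → ℤ) → ℤ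
sumTo zero f = f zero
sumTo (suc n) f = sumTo n f + f (suc n)

infixl 6 _⊕_
infixl 7 _⊗_

_⊕_ : Series → Series → Series
(f ⊕ g) n = f n + g n

_⊗_ : Series → Series → Series
(f ⊗ g) n = sumTo n (λ i → f i * g (n ∸ i))

poly : List ℤ → Series
poly [] n = + 0
poly (c ∷ cs) zero = c
poly (c ∷ cs) (suc n) = poly cs n

one X : Series
one = poly (+ 1 ∷ [])
X = poly (+ 0 ∷ + 1 ∷ [])

oneMinusX : Series
oneMinusX = poly (+ 1 ∷ - (+ 1) ∷ [])

-- An avoider of 321, 1243 and 2143 of length n + 1 is obtained from one of length n by inserting
-- the maximum n + 1, and the insertion is admissible exactly when the entries after it increase
-- and at most one entry before it is smaller than one after it.  Following the admissible
-- insertions shows that the avoiders are exactly the words κ ⊕ 12⋯t, where the core κ is empty or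
-- an inflation of 21, 132, 2413 or 3142 by increasing runs of consecutive values.  The parameters
-- of the words of each kind form weak compositions, which gives the binomial count.  For n ≥ 1 the
-- count is a cubic polynomial in n, so its fourth difference vanishes from n = 5 on; multiplying
-- by (1 - x)⁴ takes fourth differences, and the remaining coefficients are computed.
module Submission where

open import Defs
open import Data.Nat using (ℕ; zero; suc; pred; _+_; _*_; _∸_; _≥_; _≤_; _<_; _≤?_; _≟_; z≤n; s≤s)
open import Data.Nat.Properties
  using ( <-asym; <-trans; <-irrefl; <-cmp; <⇒≢; ≤-refl; ≤-reflexive; ≤-trans; <-≤-trans; ≤-<-trans
        ; n≤1+n; m≤m+n; m≤n+m; m≤n⇒m≤n+o; m≤n⇒m≤1+n; m≤n⇒m<n∨m≡n; m+n∸n≡m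
        ; +-suc; +-identityʳ; +-assoc; +-comm; *-identityˡ; suc-injective )
open import Data.Nat.Combinatorics using (_C_; nCn≡1; nCk+nC[k+1]≡[n+1]C[k+1])
open import Data.Nat.ListAction using (sum)
open import Data.Nat.Tactic.RingSolver using (solve-∀)
open import Data.Integer as ℤ using (ℤ; +_; -_)
import Data.Integer.Properties as ℤ
import Data.Integer.Tactic.RingSolver as ℤ-Solver
open import Data.Fin using (Fin; zero; suc; cast; #_)
open import Data.Vec as Vec using (Vec; []; _∷_)
open import Data.List
  using (List; []; _∷_; _++_; [_]; head; length; lookup; map; concat; concatMap; applyUpTo; allFin)
open import Data.List.Properties using (length-map; length-++; ++-identityʳ; ++-assoc; ∷-injective)
open import Data.List.Membership.Propositional using (_∈_)
open import Data.List.Membership.Propositional.Properties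
  using (∈-lookup; ∈-∃++; ∈-++⁺ˡ; ∈-++⁺ʳ; ∈-++⁻; ∈-map⁺; ∈-map⁻; ∈-concatMap⁻; ∈-concat⁺′; ∈-allFin)
open import Data.List.Relation.Unary.Any using (here; there; satisfied)
open import Data.List.Relation.Unary.All as All using (All; []; _∷_)
import Data.List.Relation.Unary.All.Properties as All
open import Data.List.Relation.Unary.AllPairs as AllPairs using (AllPairs; []; _∷_)
import Data.List.Relation.Unary.AllPairs.Properties as AllPairs
open import Data.List.Relation.Unary.Linked using (Linked; []; [-]; _∷_)
open import Data.List.Relation.Unary.Unique.Propositional using (Unique)
import Data.List.Relation.Unary.Unique.Propositional.Properties as Unique
open import Data.List.Relation.Binary.Disjoint.Propositional using (Disjoint)
open import Data.List.Relation.Binary.Sublist.Propositional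
  using (_⊆_; []; _∷_; _∷ʳ_; ⊆-refl; ⊆-trans; minimum; to∈; from∈)
open import Data.List.Relation.Binary.Sublist.Propositional.Properties using (++⁺; ++⁺ˡ; ++⁺ʳ; All-resp-⊆)
open import Data.List.Relation.Binary.Permutation.Propositional
  using (_↭_; ↭-refl; ↭-sym; ↭-trans; ↭-reflexive; prep)
open import Data.List.Relation.Binary.Permutation.Propositional.Properties
  using (shift; drop-mid; ∈-resp-↭; ∷↭∷ʳ; ↭-empty-inv; ↭-length)
open import Data.Maybe using (just)
open import Data.Maybe.Properties using (just-injective)
open import Data.Product using (Σ; ∃; ∃₂; _×_; _,_; proj₁; proj₂; uncurry)
open import Data.Sum using (_⊎_; inj₁; inj₂)
open import Function.Base using (_∘_)
open import Function.Bundles using (_⇔_; mk⇔; Equivalence)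
open import Relation.Binary.Definitions using (tri<; tri≈; tri>)
open import Relation.Nullary using (¬_; yes; no; contradiction)
open import Relation.Nullary.Decidable using (True; toWitness)
open import Relation.Binary.PropositionalEquality
  using (_≡_; _≢_; refl; sym; trans; cong; cong₂; subst; subst₂; module ≡-Reasoning)

private variable
  a b c d e k l l′ m n p s s′ t x y z M : ℕ
  q q₁ q₂ u u₁ u₂ v w vs π P Q W : List ℕ
  rs : List (ℕ × ℕ)

-- Intervals of consecutive values

interval : ℕ → ℕ → List ℕ
interval s zero    = []
interval s (suc l) = s ∷ interval (suc s) l

∈-interval⁻ : x ∈ interval s l → s ≤ x × x < s + l
∈-interval⁻ {s = s} {l = suc l} (here refl) = ≤-refl , subst (s <_) (sym (+-suc s l)) (s≤s (m≤m+n s l))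
∈-interval⁻ {x = x} {s = s} {l = suc l} (there x∈) with ∈-interval⁻ x∈
... | s<x , x<s+l = ≤-trans (n≤1+n s) s<x , subst (x <_) (sym (+-suc s l)) x<s+l

interval-≥ : ∀ s l → b ≤ s → All (b ≤_) (interval s l)
interval-≥ s l b≤s = All.tabulate (λ x∈ → ≤-trans b≤s (proj₁ (∈-interval⁻ x∈)))

interval-< : ∀ s l → s + l ≤ b → All (_< b) (interval s l)
interval-< s l s+l≤b = All.tabulate (λ x∈ → <-≤-trans (proj₂ (∈-interval⁻ x∈)) s+l≤b)

interval-snoc : x ≡ s + l → interval s l ++ [ x ] ≡ interval s (suc l)
interval-snoc {s = s} {l = zero}  refl = cong [_] (+-identityʳ s)
interval-snoc {s = s} {l = suc l} refl = cong (s ∷_) (interval-snoc (+-suc s l))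

interval-grow : ∀ s l → x ≡ s + l → ∀ Q → interval s l ++ x ∷ Q ≡ interval s (suc l) ++ Q
interval-grow {x} s l x≡ Q = trans (sym (++-assoc (interval s l) [ x ] Q)) (cong (_++ Q) (interval-snoc x≡))

interval-increasing : ∀ s l → AllPairs _<_ (interval s l)
interval-increasing s zero    = []
interval-increasing s (suc l) = All.tabulate (λ x∈ → proj₁ (∈-interval⁻ x∈)) ∷ interval-increasing (suc s) l

intervals-increasing : ∀ s l s′ l′ → s + l ≤ s′ → AllPairs _<_ (interval s l ++ interval s′ l′)
intervals-increasing s l s′ l′ s+l≤s′ =
  AllPairs.++⁺ (interval-increasing s l) (interval-increasing s′ l′)
    (All.tabulate (λ x∈ → interval-≥ s′ l′ (<-≤-trans (proj₂ (∈-interval⁻ x∈)) s+l≤s′)))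

interval-split : ∀ s l u v → u ++ v ≡ interval s l →
  ∃₂ λ i j → i + j ≡ l × u ≡ interval s i × v ≡ interval (i + s) j
interval-split s l       []      v eq = 0 , l , refl , refl , eq
interval-split s (suc l) (x ∷ u) v eq with ∷-injective eq
... | refl , eq′ with interval-split (suc s) l u v eq′
...   | i , j , refl , refl , refl = suc i , j , refl , refl , cong (λ s → interval s j) (+-suc i s)

length-interval : ∀ s l → length (interval s l) ≡ l
length-interval s zero    = refl
length-interval s (suc l) = cong suc (length-interval (suc s) l)

applyUpTo≡interval : ∀ (f : ℕ → ℕ) s n → (∀ i → f i ≡ s + i) → applyUpTo f n ≡ interval s n
applyUpTo≡interval f s zero    f≗s+ = refl
applyUpTo≡interval f s (suc n) f≗s+ =
  cong₂ _∷_ (trans (f≗s+ 0) (+-identityʳ s))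
            (applyUpTo≡interval (λ i → f (suc i)) (suc s) n (λ i → trans (f≗s+ (suc i)) (+-suc s i)))


++-split : ∀ {A : Set} (u v P Q : List A) → u ++ v ≡ P ++ Q →
  (∃ λ m → u ≡ P ++ m × Q ≡ m ++ v) ⊎ (∃ λ m → P ≡ u ++ m × v ≡ m ++ Q)
++-split []      v P       Q eq = inj₂ (P , refl , eq)
++-split (x ∷ u) v []      Q eq = inj₁ (x ∷ u , refl , sym eq)
++-split (x ∷ u) v (y ∷ P) Q eq with ∷-injective eq
... | refl , eq′ with ++-split u v P Q eq′
...   | inj₁ (m , refl , Q≡) = inj₁ (m , refl , Q≡)
...   | inj₂ (m , refl , v≡) = inj₂ (m , refl , v≡)

⊆-insert : ∀ u m → u ++ v ⊆ u ++ m ∷ v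
⊆-insert u m = ++⁺ (⊆-refl {x = u}) (m ∷ʳ ⊆-refl)

⊆-split : ∀ u → q ⊆ u ++ m ∷ v →
  (q ⊆ u ++ v) ⊎ (∃₂ λ q₁ q₂ → q ≡ q₁ ++ m ∷ q₂ × q₁ ⊆ u × q₂ ⊆ v)
⊆-split []      (_ ∷ʳ τ)    = inj₁ τ
⊆-split []      (refl ∷ τ)  = inj₂ ([] , _ , refl , [] , τ)
⊆-split (x ∷ u) (.x ∷ʳ τ) with ⊆-split u τ
... | inj₁ τ′                       = inj₁ (x ∷ʳ τ′)
... | inj₂ (q₁ , q₂ , eq , τ₁ , τ₂) = inj₂ (q₁ , q₂ , eq , x ∷ʳ τ₁ , τ₂)
⊆-split (x ∷ u) (refl ∷ τ) with ⊆-split u τ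
... | inj₁ τ′                          = inj₁ (refl ∷ τ′)
... | inj₂ (q₁ , q₂ , refl , τ₁ , τ₂) = inj₂ (x ∷ q₁ , q₂ , refl , refl ∷ τ₁ , τ₂)

∈-suffix : W ≡ P ++ d ∷ v → d ∈ W
∈-suffix {P = P} refl = ∈-++⁺ʳ P (here refl)

suffix-meets : ∀ k P → k ++ d ∷ v ≡ P ++ y ∷ Q → ∃ λ d′ → d′ ∈ d ∷ v × d′ ∈ y ∷ Q
suffix-meets {d} {v} {y} {Q} k P eq with ++-split k (d ∷ v) P (y ∷ Q) eq
... | inj₁ (m , _ , y∷Q≡) = d , here refl , ∈-suffix y∷Q≡
... | inj₂ (m , _ , v≡)   = y , ∈-suffix v≡ , here refl


-- Patterns

Occurs : (List ℕ → Set) → List ℕ → Set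
Occurs P w = ∃ λ q → q ⊆ w × P q

occurs-mono : ∀ {P} → u ⊆ w → Occurs P u → Occurs P w
occurs-mono u⊆w (q , q⊆u , Pq) = q , ⊆-trans q⊆u u⊆w , Pq

occurs-map : ∀ {P Q : List ℕ → Set} → (∀ {q} → P q → Q q) → Occurs P w → Occurs Q w
occurs-map f (q , q⊆w , Pq) = q , q⊆w , f Pq

data Is21 : List ℕ → Set where
  is21 : y < x → Is21 (x ∷ y ∷ [])

Has21 : List ℕ → Set
Has21 = Occurs Is21

data Is321 : List ℕ → Set where
  is321 : y < x → z < y → Is321 (x ∷ y ∷ z ∷ [])

data Is1243or2143 : List ℕ → Set where
  is1243or2143 : ∀ {a b c d} → a < d → b < d → d < c → a ≢ b → Is1243or2143 (a ∷ b ∷ c ∷ d ∷ [])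

Avoids₀ : List ℕ → Set
Avoids₀ w = ¬ Occurs Is321 w × ¬ Occurs Is1243or2143 w

data TwoBelow (u v : List ℕ) : Set where
  twoBelow : x ∷ y ∷ [] ⊆ u → d ∈ v → x < d → y < d → x ≢ y → TwoBelow u v

descent-in : ∀ {x y W W′} → W ≡ W′ → x ∷ y ∷ [] ⊆ W′ → y < x → Has21 W
descent-in refl τ y<x = _ , τ , is21 y<x

twoBelow< : ∀ {u v x y d} → x ∷ y ∷ [] ⊆ u → d ∈ v → x < y → y < d → TwoBelow u v
twoBelow< τ d∈ x<y y<d = twoBelow τ d∈ (<-trans x<y y<d) y<d (<⇒≢ x<y)

twoBelow> : ∀ {u v x y d} → x ∷ y ∷ [] ⊆ u → d ∈ v → y < x → x < d → TwoBelow u v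
twoBelow> τ d∈ y<x x<d = twoBelow τ d∈ x<d (<-trans y<x x<d) (λ x≡y → <⇒≢ y<x (sym x≡y))

-- vs ‼ k is the entry of rank k in vs; ranks start at 1, and 0 stands in for ranks out of range.
_‼_ : List ℕ → ℕ → ℕ
(v ∷ vs) ‼ suc zero    = v
(v ∷ vs) ‼ suc (suc k) = vs ‼ suc k
_        ‼ _           = 0

Rank : ℕ → ℕ → Set
Rank k a = 1 ≤ a × a ≤ k

rank : ∀ {k a} {_ : True (1 ≤? a)} {_ : True (a ≤? k)} → Rank k a
rank {_} {_} {1≤a} {a≤k} = toWitness 1≤a , toWitness a≤k

lit< : ∀ {m n} {_ : True (suc m ≤? n)} → m < n
lit< {_} {_} {m<n} = toWitness m<n

‼-<-mono : Linked _<_ vs → Rank (length vs) a → Rank (length vs) b → a < b → vs ‼ a < vs ‼ b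
‼-<-mono []  (s≤s _ , ()) _ _
‼-<-mono [-] (s≤s z≤n , s≤s z≤n) (s≤s z≤n , s≤s z≤n) (s≤s ())
‼-<-mono {a = 1} {b = 2} (v<w ∷ _) _ _ _ = v<w
‼-<-mono {a = 1} {b = suc (suc (suc b))} (v<w ∷ lk) _ (_ , s≤s b≤) _ =
  <-trans v<w (‼-<-mono lk (s≤s z≤n , s≤s z≤n) (s≤s z≤n , b≤) (s≤s (s≤s z≤n)))
‼-<-mono {a = suc (suc a)} {b = suc (suc b)} (_ ∷ lk) (_ , s≤s a≤) (_ , s≤s b≤) (s≤s a<b) =
  ‼-<-mono lk (s≤s z≤n , a≤) (s≤s z≤n , b≤) a<b
‼-<-mono {a = zero} (_ ∷ _) (() , _) _ _
‼-<-mono {a = suc _} {b = zero} (_ ∷ _) _ _ ()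
‼-<-mono {a = 1} {b = 1} (_ ∷ _) _ _ (s≤s ())
‼-<-mono {a = suc (suc _)} {b = 1} (_ ∷ _) _ _ (s≤s ())

‼-<⇔ : Linked _<_ vs → Rank (length vs) a → Rank (length vs) b → (vs ‼ a < vs ‼ b) ⇔ (a < b)
‼-<⇔ {a = a} {b = b} lk ra rb = mk⇔ reflect (‼-<-mono lk ra rb)
  where
  reflect : _ → a < b
  reflect lt with <-cmp a b
  ... | tri< a<b _ _ = a<b
  ... | tri≈ _ refl _ = contradiction lt (<-irrefl refl)
  ... | tri> _ _ b<a = contradiction lt (<-asym (‼-<-mono lk rb ra b<a))

lookup-map : ∀ (f : ℕ → ℕ) xs i → lookup (map f xs) i ≡ f (lookup xs (cast (length-map f xs) i))
lookup-map f (x ∷ xs) zero    = refl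
lookup-map f (x ∷ xs) (suc i) = lookup-map f xs i

map-sameOrder : ∀ (f : ℕ → ℕ) π → (∀ {a b} → a ∈ π → b ∈ π → (f a < f b) ⇔ (a < b)) → SameOrder (map f π) π
map-sameOrder f π f-reflects = length-map f π , λ i j →
  subst₂ (λ x y → (x < y) ⇔ (lookup π (cast (length-map f π) i) < lookup π (cast (length-map f π) j)))
         (sym (lookup-map f π i)) (sym (lookup-map f π j))
         (f-reflects (∈-lookup _) (∈-lookup _))

relabel-sameOrder : Linked _<_ vs → All (Rank (length vs)) π → SameOrder (map (vs ‼_) π) π
relabel-sameOrder {π = π} lk ranks =
  map-sameOrder _ π (λ a∈ b∈ → ‼-<⇔ lk (All.lookup ranks a∈) (All.lookup ranks b∈))

sameOrder321⇒ : SameOrder q (3 ∷ 2 ∷ 1 ∷ []) → Is321 q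
sameOrder321⇒ {x ∷ y ∷ z ∷ []} (_ , h) = is321 (from (h (# 1) (# 0)) lit<) (from (h (# 2) (# 1)) lit<)
  where open Equivalence

sameOrder1243⇒ : SameOrder q (1 ∷ 2 ∷ 4 ∷ 3 ∷ []) → Is1243or2143 q
sameOrder1243⇒ {a ∷ b ∷ c ∷ d ∷ []} (_ , h) =
  is1243or2143 (from (h (# 0) (# 3)) lit<) (from (h (# 1) (# 3)) lit<) (from (h (# 3) (# 2)) lit<)
               (<⇒≢ (from (h (# 0) (# 1)) lit<))
  where open Equivalence

sameOrder2143⇒ : SameOrder q (2 ∷ 1 ∷ 4 ∷ 3 ∷ []) → Is1243or2143 q
sameOrder2143⇒ {a ∷ b ∷ c ∷ d ∷ []} (_ , h) =
  is1243or2143 (from (h (# 0) (# 3)) lit<) (from (h (# 1) (# 3)) lit<) (from (h (# 3) (# 2)) lit<)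
               (λ a≡b → <⇒≢ (from (h (# 1) (# 0)) lit<) (sym a≡b))
  where open Equivalence

is321⇒sameOrder : Is321 q → SameOrder q (3 ∷ 2 ∷ 1 ∷ [])
is321⇒sameOrder (is321 y<x z<y) = relabel-sameOrder (z<y ∷ y<x ∷ [-]) (rank ∷ rank ∷ rank ∷ [])

is1243or2143⇒sameOrder : Is1243or2143 q → SameOrder q (1 ∷ 2 ∷ 4 ∷ 3 ∷ []) ⊎ SameOrder q (2 ∷ 1 ∷ 4 ∷ 3 ∷ [])
is1243or2143⇒sameOrder (is1243or2143 {a} {b} a<d b<d d<c a≢b) with <-cmp a b
... | tri< a<b _ _ = inj₁ (relabel-sameOrder (a<b ∷ b<d ∷ d<c ∷ [-]) (rank ∷ rank ∷ rank ∷ rank ∷ []))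
... | tri≈ _ a≡b _ = contradiction a≡b a≢b
... | tri> _ _ b<a = inj₂ (relabel-sameOrder (b<a ∷ a<d ∷ d<c ∷ [-]) (rank ∷ rank ∷ rank ∷ rank ∷ []))

avoids-R₀⇔ : Avoids R₀ w ⇔ Avoids₀ w
avoids-R₀⇔ {w} = mk⇔ to from
  where
  to : Avoids R₀ w → Avoids₀ w
  to (¬1243 ∷ ¬2143 ∷ ¬321 ∷ []) = ¬321 ∘ occurs-map is321⇒sameOrder , ¬1243or2143
    where
    ¬1243or2143 : ¬ Occurs Is1243or2143 w
    ¬1243or2143 (q , τ , occ) with is1243or2143⇒sameOrder occ
    ... | inj₁ so = ¬1243 (q , τ , so)
    ... | inj₂ so = ¬2143 (q , τ , so)
  from : Avoids₀ w → Avoids R₀ w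
  from (¬321 , ¬1243or2143) =
    ¬1243or2143 ∘ occurs-map sameOrder1243⇒ ∷ ¬1243or2143 ∘ occurs-map sameOrder2143⇒ ∷
    ¬321 ∘ occurs-map sameOrder321⇒ ∷ []


-- Inserting a new maximum

max-in-321 : All (_< m) q₁ → Is321 (q₁ ++ m ∷ q₂) → Is21 q₂
max-in-321 []                     (is321 _ z<y) = is21 z<y
max-in-321 (x<m ∷ [])             (is321 m<x _) = contradiction m<x (<-asym x<m)
max-in-321 (_ ∷ y<m ∷ [])         (is321 _ m<y) = contradiction m<y (<-asym y<m)
max-in-321 (_ ∷ _ ∷ _ ∷ [])       ()
max-in-321 (_ ∷ _ ∷ _ ∷ _ ∷ _)    ()

max-in-1243or2143 : All (_< m) q₁ → All (_< m) q₂ → q₁ ⊆ u → q₂ ⊆ v →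
  Is1243or2143 (q₁ ++ m ∷ q₂) → TwoBelow u v
max-in-1243or2143 []               (_ ∷ _ ∷ d<m ∷ []) _ _ (is1243or2143 m<d _ _ _) = contradiction m<d (<-asym d<m)
max-in-1243or2143 (_ ∷ [])         (_ ∷ d<m ∷ [])     _ _ (is1243or2143 _ m<d _ _) = contradiction m<d (<-asym d<m)
max-in-1243or2143 (_ ∷ _ ∷ [])     _  τ₁ τ₂ (is1243or2143 a<d b<d _ a≢b) = twoBelow τ₁ (to∈ τ₂) a<d b<d a≢b
max-in-1243or2143 (_ ∷ _ ∷ c<m ∷ []) _ _ _ (is1243or2143 _ _ m<c _) = contradiction m<c (<-asym c<m)
max-in-1243or2143 (_ ∷ _ ∷ _ ∷ _ ∷ [])    _ _ _ ()
max-in-1243or2143 (_ ∷ _ ∷ _ ∷ _ ∷ _ ∷ _) _ _ _ ()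

-- A new maximum can only play the part of the 3 of 321 or of the 4 of 1243 and 2143.
insertMax⇔ : All (_< m) (u ++ v) →
  Avoids₀ (u ++ m ∷ v) ⇔ (Avoids₀ (u ++ v) × ¬ Has21 v × ¬ TwoBelow u v)
insertMax⇔ {m} {u} {v} bound = mk⇔ to from
  where
  below-u = All.++⁻ˡ u bound
  below-v = All.++⁻ʳ u bound

  to : Avoids₀ (u ++ m ∷ v) → Avoids₀ (u ++ v) × ¬ Has21 v × ¬ TwoBelow u v
  to (¬321 , ¬Q) =
    ((λ occ → ¬321 (occurs-mono (⊆-insert u m) occ)) , (λ occ → ¬Q (occurs-mono (⊆-insert u m) occ))) ,
    (λ { (_ , τ , is21 y<x) → ¬321 (_ , ++⁺ˡ u (refl ∷ τ) , is321 (All.lookup below-v (to∈ τ)) y<x) }) ,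
    (λ { (twoBelow τ d∈v x<d y<d x≢y) →
           ¬Q (_ , ++⁺ τ (refl ∷ from∈ d∈v) , is1243or2143 x<d y<d (All.lookup below-v d∈v) x≢y) })

  from : Avoids₀ (u ++ v) × ¬ Has21 v × ¬ TwoBelow u v → Avoids₀ (u ++ m ∷ v)
  from ((¬321 , ¬Q) , ¬21 , ¬2B) = no321 , noQ
    where
    no321 : ¬ Occurs Is321 (u ++ m ∷ v)
    no321 (q , τ , occ) with ⊆-split u τ
    ... | inj₁ τ′ = ¬321 (q , τ′ , occ)
    ... | inj₂ (q₁ , q₂ , refl , τ₁ , τ₂) =
      ¬21 (q₂ , τ₂ , max-in-321 (All-resp-⊆ τ₁ below-u) occ)
    noQ : ¬ Occurs Is1243or2143 (u ++ m ∷ v)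
    noQ (q , τ , occ) with ⊆-split u τ
    ... | inj₁ τ′ = ¬Q (q , τ′ , occ)
    ... | inj₂ (q₁ , q₂ , refl , τ₁ , τ₂) =
      ¬2B (max-in-1243or2143 (All-resp-⊆ τ₁ below-u) (All-resp-⊆ τ₂ below-v) τ₁ τ₂ occ)

perm-insertMax : u ++ v ↭ interval 1 n → u ++ suc n ∷ v ↭ interval 1 (suc n)
perm-insertMax {u} {v} {n} p =
  ↭-trans (shift (suc n) u v)
    (↭-trans (prep (suc n) p) (↭-trans (∷↭∷ʳ (suc n) (interval 1 n)) (↭-reflexive (interval-snoc refl))))

perm-removeMax : w ↭ interval 1 (suc n) → ∃₂ λ u v → w ≡ u ++ suc n ∷ v × u ++ v ↭ interval 1 n
perm-removeMax {w} {n} p with ∈-∃++ (∈-resp-↭ (↭-sym p) max∈)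
  where
  max∈ : suc n ∈ interval 1 (suc n)
  max∈ = subst (suc n ∈_) (interval-snoc refl) (∈-++⁺ʳ (interval 1 n) (here refl))
... | u , v , refl =
  u , v , refl ,
  subst (u ++ v ↭_) (++-identityʳ _) (drop-mid u (interval 1 n) (subst (w ↭_) (sym (interval-snoc refl)) p))

perm-bounded : w ↭ interval 1 n → All (_< suc n) w
perm-bounded p = All.tabulate (λ x∈ → proj₂ (∈-interval⁻ (∈-resp-↭ p x∈)))

pair-ordered : AllPairs _<_ v → x ∷ y ∷ [] ⊆ v → x < y
pair-ordered (_ ∷ ap)       (_ ∷ʳ τ)   = pair-ordered ap τ
pair-ordered (x<all ∷ _)    (refl ∷ τ) = All.lookup x<all (to∈ τ)

increasing⇒¬Has21 : AllPairs _<_ v → ¬ Has21 v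
increasing⇒¬Has21 ap (_ , τ , is21 y<x) = <-asym y<x (pair-ordered ap τ)

¬Has21-[] : ¬ Has21 []
¬Has21-[] (_ , [] , ())

¬TwoBelow-[] : ∀ u → ¬ TwoBelow u []
¬TwoBelow-[] u (twoBelow _ () _ _ _)

¬TwoBelow-[_] : ∀ z → ¬ TwoBelow [ z ] v
¬TwoBelow-[ z ] (twoBelow (_ ∷ʳ ()) _ _ _ _)
¬TwoBelow-[ z ] (twoBelow (_ ∷ ()) _ _ _ _)

pair-misses : ∀ u₁ → x ∷ y ∷ [] ⊆ u₁ ++ z ∷ u₂ → x ∈ u₁ ++ u₂ ⊎ y ∈ u₁ ++ u₂
pair-misses u₁ τ with ⊆-split u₁ τ
... | inj₁ τ′                                  = inj₁ (to∈ τ′)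
... | inj₂ ([] , _ ∷ [] , refl , _ , τ₂)      = inj₂ (∈-++⁺ʳ u₁ (to∈ τ₂))
... | inj₂ (_ ∷ [] , [] , refl , τ₁ , _)      = inj₁ (∈-++⁺ˡ (to∈ τ₁))
... | inj₂ ([] , [] , () , _)
... | inj₂ ([] , _ ∷ _ ∷ _ , () , _)
... | inj₂ (_ ∷ [] , _ ∷ _ , () , _)
... | inj₂ (_ ∷ _ ∷ [] , _ , () , _)
... | inj₂ (_ ∷ _ ∷ _ ∷ _ , _ , () , _)

¬TwoBelow-sep : ∀ u₁ → All (M ≤_) (u₁ ++ u₂) → All (_< M) v → ¬ TwoBelow (u₁ ++ z ∷ u₂) v
¬TwoBelow-sep u₁ high low (twoBelow τ d∈v x<d y<d _) with pair-misses u₁ τ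
... | inj₁ x∈ = <-asym (All.lookup low d∈v) (≤-<-trans (All.lookup high x∈) x<d)
... | inj₂ y∈ = <-asym (All.lookup low d∈v) (≤-<-trans (All.lookup high y∈) y<d)

after-descent : ∀ u P → u ++ v ≡ P ++ y ∷ Q → All (y <_) P → ¬ Has21 v →
  (u ≡ P × v ≡ y ∷ Q) ⊎ (∃ λ k → u ≡ P ++ y ∷ k × Q ≡ k ++ v)
after-descent {v} {y} {Q} u P eq P>y ¬21 with ++-split u v P (y ∷ Q) eq
... | inj₁ ([] , u≡ , y∷Q≡) = inj₁ (trans u≡ (++-identityʳ P) , sym y∷Q≡)
... | inj₁ (_ ∷ k , u≡ , y∷Q≡) with ∷-injective y∷Q≡
...   | refl , Q≡ = inj₂ (k , u≡ , Q≡)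
after-descent u P eq P>y ¬21 | inj₂ ([] , P≡ , v≡) = inj₁ (sym (trans P≡ (++-identityʳ u)) , v≡)
after-descent {y = y} u P eq P>y ¬21 | inj₂ (x ∷ m , refl , refl) =
  contradiction (_ , refl ∷ from∈ (∈-++⁺ʳ m (here refl)) , is21 (All.lookup P>y (∈-++⁺ʳ u (here refl)))) ¬21


-- The words κ ⊕ 12⋯t

-- A nonempty core inflates 21, 132, 2413 or 3142 by increasing runs of consecutive values: each
-- parameter is the length of its run minus one, and the runs without a parameter are single points.
data Core : Set where
  ι             : Core
  ⟨21⟩ ⟨132⟩     : (a c : ℕ) → Core
  ⟨2413⟩ ⟨3142⟩  : (p c e : ℕ) → Core

∣_∣ : Core → ℕ
∣ ι ∣            = 0
∣ ⟨21⟩ a c ∣     = 2 + a + c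
∣ ⟨132⟩ a c ∣    = 3 + a + c
∣ ⟨2413⟩ p c e ∣ = 4 + p + c + e
∣ ⟨3142⟩ p c e ∣ = 4 + p + c + e

core : Core → List ℕ
core ι            = []
core (⟨21⟩ a c)     = interval (2 + a) (suc c) ++ interval 1 (suc a)
core (⟨132⟩ a c)    = 1 ∷ interval (3 + a) (suc c) ++ interval 2 (suc a)
core (⟨2413⟩ p c e) = 2 + p ∷ interval (4 + p + c) (suc e) ++ interval 1 (suc p) ++ interval (3 + p) (suc c)
core (⟨3142⟩ p c e) = interval (3 + p) (suc c) ++ 1 ∷ interval (4 + p + c) (suc e) ++ interval 2 (suc p)

word : Core → ℕ → List ℕ
word κ t = core κ ++ interval (suc ∣ κ ∣) t

IsWord : ℕ → List ℕ → Set
IsWord n w = ∃₂ λ κ t → ∣ κ ∣ + t ≡ n × w ≡ word κ t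

coreIsWord : ∀ κ → ∣ κ ∣ ≡ n → w ≡ core κ → IsWord n w
coreIsWord κ refl refl = κ , 0 , +-identityʳ ∣ κ ∣ , sym (++-identityʳ (core κ))

ExtendsWord : ℕ → List ℕ → Set
ExtendsWord n w = ∃₂ λ u v → w ≡ u ++ suc n ∷ v × IsWord n (u ++ v) × ¬ Has21 v × ¬ TwoBelow u v

word-snoc : ∀ κ t → word κ t ++ [ suc (∣ κ ∣ + t) ] ≡ word κ (suc t)
word-snoc κ t = trans (++-assoc (core κ) _ _) (cong (core κ ++_) (interval-snoc refl))

extendsWord-tail : ∀ κ t → ExtendsWord (∣ κ ∣ + t) (word κ (suc t))
extendsWord-tail κ t =
  word κ t , [] , sym (word-snoc κ t) , (κ , t , refl , ++-identityʳ _) , ¬Has21-[] , ¬TwoBelow-[] _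

extendsWord-21 : ∀ a c → ExtendsWord (1 + a + c) (core (⟨21⟩ a c))
extendsWord-21 a zero =
  [] , A , cong (λ x → 2 + x ∷ A) (sym (+-identityʳ a)) ,
  (ι , suc a , cong suc (sym (+-identityʳ a)) , refl) ,
  increasing⇒¬Has21 (interval-increasing 1 (suc a)) , λ { (twoBelow () _ _ _ _) }
  where A = interval 1 (suc a)
extendsWord-21 a (suc c) =
  interval (2 + a) (suc c) , A , sym (interval-grow (2 + a) (suc c) refl A) ,
  coreIsWord (⟨21⟩ a c) (sym (+-suc (1 + a) c)) refl ,
  increasing⇒¬Has21 (interval-increasing 1 (suc a)) ,
  ¬TwoBelow-sep [] (interval-≥ (3 + a) c (n≤1+n _)) (interval-< 1 (suc a) ≤-refl)
  where A = interval 1 (suc a)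

extendsWord-132 : ∀ a c → ExtendsWord (2 + a + c) (core (⟨132⟩ a c))
extendsWord-132 a zero =
  [ 1 ] , A , cong (λ x → 1 ∷ 3 + x ∷ A) (sym (+-identityʳ a)) ,
  (ι , 2 + a , sym (+-identityʳ (2 + a)) , refl) ,
  increasing⇒¬Has21 (interval-increasing 2 (suc a)) , ¬TwoBelow-[ 1 ]
  where A = interval 2 (suc a)
extendsWord-132 a (suc c) =
  1 ∷ interval (3 + a) (suc c) , A , cong (1 ∷_) (sym (interval-grow (3 + a) (suc c) refl A)) ,
  coreIsWord (⟨132⟩ a c) (sym (+-suc (2 + a) c)) refl ,
  increasing⇒¬Has21 (interval-increasing 2 (suc a)) ,
  ¬TwoBelow-sep [] (interval-≥ (3 + a) (suc c) ≤-refl) (interval-< 2 (suc a) ≤-refl)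
  where A = interval 2 (suc a)

extendsWord-2413 : ∀ p c e → ExtendsWord (3 + p + c + e) (core (⟨2413⟩ p c e))
extendsWord-2413 p c zero =
  [ 2 + p ] , AC , cong (λ x → 2 + p ∷ suc x ∷ AC) (sym (+-identityʳ (3 + p + c))) ,
  (⟨21⟩ p 0 , suc c , size , cong (λ x → 2 + p ∷ A ++ interval (suc x) (suc c)) (sym (+-identityʳ (2 + p)))) ,
  increasing⇒¬Has21 (intervals-increasing 1 (suc p) (3 + p) (suc c) (n≤1+n _)) , ¬TwoBelow-[ 2 + p ]
  where
  A = interval 1 (suc p)
  AC = A ++ interval (3 + p) (suc c)
  size : 2 + p + 0 + suc c ≡ 3 + p + c + 0
  size = trans (+-suc (2 + p + 0) c) (trans (cong (λ x → suc (x + c)) (+-identityʳ (2 + p))) (sym (+-identityʳ _)))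
extendsWord-2413 p c (suc e) =
  2 + p ∷ interval (4 + p + c) (suc e) , AC , cong (2 + p ∷_) (sym (interval-grow (4 + p + c) (suc e) refl AC)) ,
  coreIsWord (⟨2413⟩ p c e) (sym (+-suc (3 + p + c) e)) refl ,
  increasing⇒¬Has21 (intervals-increasing 1 (suc p) (3 + p) (suc c) (n≤1+n _)) ,
  ¬TwoBelow-sep [] (interval-≥ (4 + p + c) (suc e) ≤-refl)
    (All.++⁺ (interval-< 1 (suc p) (m≤n⇒m≤n+o c (≤-trans (n≤1+n _) (n≤1+n _))))
             (interval-< (3 + p) (suc c) (≤-reflexive (+-suc (3 + p) c))))
  where AC = interval 1 (suc p) ++ interval (3 + p) (suc c)

extendsWord-3142 : ∀ p c e → ExtendsWord (3 + p + c + e) (core (⟨3142⟩ p c e))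
extendsWord-3142 p c zero =
  Γ ++ [ 1 ] , A , trans (cong (λ x → Γ ++ 1 ∷ suc x ∷ A) (sym (+-identityʳ (3 + p + c)))) (sym (++-assoc Γ _ _)) ,
  coreIsWord (⟨21⟩ (suc p) c) (sym (+-identityʳ (3 + p + c))) (++-assoc Γ _ _) ,
  increasing⇒¬Has21 (interval-increasing 2 (suc p)) ,
  ¬TwoBelow-sep Γ (subst (All _) (sym (++-identityʳ Γ)) (interval-≥ (3 + p) (suc c) ≤-refl))
    (interval-< 2 (suc p) ≤-refl)
  where
  Γ = interval (3 + p) (suc c)
  A = interval 2 (suc p)
extendsWord-3142 p c (suc e) =
  Γ ++ 1 ∷ interval (4 + p + c) (suc e) , A ,
  trans (cong (λ x → Γ ++ 1 ∷ x) (sym (interval-grow (4 + p + c) (suc e) refl A))) (sym (++-assoc Γ _ _)) ,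
  coreIsWord (⟨3142⟩ p c e) (sym (+-suc (3 + p + c) e)) (++-assoc Γ _ _) ,
  increasing⇒¬Has21 (interval-increasing 2 (suc p)) ,
  ¬TwoBelow-sep Γ
    (All.++⁺ (interval-≥ (3 + p) (suc c) ≤-refl) (interval-≥ (4 + p + c) (suc e) (m≤n⇒m≤n+o c (n≤1+n _))))
    (interval-< 2 (suc p) ≤-refl)
  where
  Γ = interval (3 + p) (suc c)
  A = interval 2 (suc p)

extendsWord-core : ∀ κ → ∣ κ ∣ + 0 ≡ suc n → ExtendsWord (pred ∣ κ ∣) (core κ) → ExtendsWord n (word κ 0)
extendsWord-core κ eq =
  subst₂ ExtendsWord (cong pred (trans (sym (+-identityʳ ∣ κ ∣)) eq)) (sym (++-identityʳ (core κ)))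

extendsWord : IsWord (suc n) w → ExtendsWord n w
extendsWord (κ , suc t , eq , refl) =
  subst (λ n → ExtendsWord n (word κ (suc t))) (suc-injective (trans (sym (+-suc ∣ κ ∣ t)) eq)) (extendsWord-tail κ t)
extendsWord (κ@(⟨21⟩ a c)     , zero , eq , refl) = extendsWord-core κ eq (extendsWord-21 a c)
extendsWord (κ@(⟨132⟩ a c)    , zero , eq , refl) = extendsWord-core κ eq (extendsWord-132 a c)
extendsWord (κ@(⟨2413⟩ p c e) , zero , eq , refl) = extendsWord-core κ eq (extendsWord-2413 p c e)
extendsWord (κ@(⟨3142⟩ p c e) , zero , eq , refl) = extendsWord-core κ eq (extendsWord-3142 p c e)

isWord⇒avoider : ∀ n → IsWord n w → w ↭ interval 1 n × Avoids₀ w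
isWord⇒avoider zero    (ι , zero , refl , refl) = ↭-refl , (λ { (_ , [] , ()) }) , (λ { (_ , [] , ()) })
isWord⇒avoider (suc n) isWord with extendsWord isWord
... | u , v , refl , isWord′ , ¬21 , ¬2B with isWord⇒avoider n isWord′
...   | perm , avoids = perm-insertMax perm , Equivalence.from (insertMax⇔ (perm-bounded perm)) (avoids , ¬21 , ¬2B)

core-bounded : ∀ κ → All (_< suc ∣ κ ∣) (core κ)
core-bounded κ = perm-bounded (proj₁ (isWord⇒avoider ∣ κ ∣ (coreIsWord κ refl refl)))


-- Every avoider is a word

-- Inserting the maximum before a nonempty increasing v: by after-descent, v lies in the final
-- ascending run, and as v ends with the largest entry of that run, at most one entry before v
-- may be smaller than it.  The few surviving sites either grow a run of the core or, from ι and
-- 21, create a new core.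

suc[m+n+0]≡m+suc[n] : ∀ m n → suc (m + n + 0) ≡ m + suc n
suc[m+n+0]≡m+suc[n] m n = trans (cong suc (+-identityʳ (m + n))) (sym (+-suc m n))

insertMax-ι : ∀ t u → u ++ d ∷ v ≡ interval 1 t → ¬ TwoBelow u (d ∷ v) → IsWord (suc t) (u ++ suc t ∷ d ∷ v)
insertMax-ι t u eq ¬2B with interval-split 1 t u _ eq
... | 0 , suc j , refl , refl , v≡ =
  coreIsWord (⟨21⟩ j 0) (cong (_+_ 2) (+-identityʳ j)) (cong (2 + j ∷_) v≡)
... | 1 , suc j , refl , refl , v≡ =
  coreIsWord (⟨132⟩ j 0) (cong (_+_ 3) (+-identityʳ j)) (cong (λ v → 1 ∷ 3 + j ∷ v) v≡)
... | suc (suc i) , suc j , refl , refl , v≡ with ∷-injective v≡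
...   | refl , _ = contradiction (twoBelow< (refl ∷ refl ∷ minimum _) (here refl) ≤-refl (s≤s (s≤s (m≤n+m 1 i)))) ¬2B
insertMax-ι t u eq ¬2B | _ , zero , _ , _ , ()

module _ (a : ℕ) where
  private
    A = interval 1 (suc a)
    B : ℕ → List ℕ
    B c = interval (2 + a) (suc c)
    B>1 : ∀ c → All (1 <_) (B c)
    B>1 c = interval-≥ (2 + a) (suc c) (s≤s (s≤s z≤n))

  insertMax-21-finalRun : ∀ c t → d ∷ v ≡ A ++ interval (3 + a + c) (suc t) → ¬ TwoBelow (B c) (d ∷ v) →
    IsWord (suc (2 + a + c + suc t)) (B c ++ suc (2 + a + c + suc t) ∷ d ∷ v)
  insertMax-21-finalRun zero t v≡ ¬2B =
    coreIsWord (⟨2413⟩ a t 0) (trans (+-identityʳ _) (cong suc (sym m≡)))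
      (cong₂ (λ n v → 2 + a ∷ suc n ∷ v) m≡
             (trans v≡ (cong (λ s → A ++ interval (suc s) (suc t)) (+-identityʳ (2 + a)))))
    where
    m≡ : 2 + a + 0 + suc t ≡ 3 + a + t
    m≡ = trans (cong (_+ suc t) (+-identityʳ (2 + a))) (+-suc (2 + a) t)
  insertMax-21-finalRun (suc c) t v≡ ¬2B =
    contradiction (twoBelow< (refl ∷ refl ∷ minimum _) (∈-suffix {P = A} v≡) ≤-refl
                             (All.lookup (core-bounded (⟨21⟩ a (suc c))) (there (here refl)))) ¬2B

  insertMax-21 : ∀ c t u → u ++ d ∷ v ≡ word (⟨21⟩ a c) t → ¬ Has21 (d ∷ v) → ¬ TwoBelow u (d ∷ v) →
    IsWord (suc (2 + a + c + t)) (u ++ suc (2 + a + c + t) ∷ d ∷ v)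
  insertMax-21 {d} {v} c zero u eq ¬21 ¬2B with after-descent u (B c) (trans eq (++-assoc (B c) A [])) (B>1 c) ¬21
  ... | inj₁ (refl , v≡) =
    coreIsWord (⟨21⟩ a (suc c)) (sym (suc[m+n+0]≡m+suc[n] (2 + a) c))
      (trans (cong (λ v → B c ++ suc (2 + a + c + 0) ∷ v) (trans v≡ (++-identityʳ A)))
             (interval-grow (2 + a) (suc c) (suc[m+n+0]≡m+suc[n] (2 + a) c) A))
  ... | inj₂ (k , refl , Q≡) with interval-split 2 a k (d ∷ v) (trans (sym Q≡) (++-identityʳ _))
  ...   | 0 , suc j , refl , refl , v≡ =
    coreIsWord (⟨3142⟩ j c 0) refl
      (trans (++-assoc (B c) [ 1 ] _) (cong₂ (λ n v → B c ++ 1 ∷ suc n ∷ v) (+-identityʳ _) v≡))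
  ...   | suc i , suc j , refl , refl , v≡ with ∷-injective v≡
  ...     | refl , _ =
    contradiction (twoBelow< (++⁺ˡ (B c) (refl ∷ refl ∷ minimum _)) (here refl) ≤-refl (s≤s (m≤n+m 2 i))) ¬2B
  insertMax-21 c zero u eq ¬21 ¬2B | inj₂ (k , refl , Q≡) | _ , zero , _ , _ , ()
  insertMax-21 {d} {v} c (suc t) u eq ¬21 ¬2B
    with after-descent u (B c) (trans eq (++-assoc (B c) A (interval (3 + a + c) (suc t)))) (B>1 c) ¬21
  ... | inj₁ (refl , v≡) = insertMax-21-finalRun c t v≡ ¬2B
  ... | inj₂ (k , refl , Q≡) with suffix-meets k (interval 2 a) (sym Q≡)
  ...   | d′ , d′∈v , d′∈T =
    contradiction (twoBelow> (refl ∷ ++⁺ˡ (interval (3 + a) c) (refl ∷ minimum k)) d′∈v (s≤s (s≤s z≤n))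
                     (<-≤-trans (All.lookup (core-bounded (⟨21⟩ a c)) (here refl))
                                (All.lookup (interval-≥ (3 + a + c) (suc t) ≤-refl) d′∈T))) ¬2B

module _ (a : ℕ) where
  private
    A = interval 2 (suc a)
    B : ℕ → List ℕ
    B c = interval (3 + a) (suc c)

  insertMax-132-finalRun : ∀ c t → d ∷ v ≡ A ++ interval (4 + a + c) t → ¬ TwoBelow (1 ∷ B c) (d ∷ v) →
    IsWord (suc (3 + a + c + t)) (1 ∷ B c ++ suc (3 + a + c + t) ∷ d ∷ v)
  insertMax-132-finalRun c zero v≡ ¬2B =
    coreIsWord (⟨132⟩ a (suc c)) (sym (suc[m+n+0]≡m+suc[n] (3 + a) c))
      (cong (1 ∷_) (trans (cong (λ v → B c ++ suc (3 + a + c + 0) ∷ v) (trans v≡ (++-identityʳ A)))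
                          (interval-grow (3 + a) (suc c) (suc[m+n+0]≡m+suc[n] (3 + a) c) A)))
  insertMax-132-finalRun c (suc t) v≡ ¬2B =
    contradiction (twoBelow< (refl ∷ refl ∷ minimum _) (∈-suffix {P = A} v≡) (s≤s (s≤s z≤n))
                             (All.lookup (core-bounded (⟨132⟩ a c)) (there (here refl)))) ¬2B

  insertMax-132 : ∀ c t u → u ++ d ∷ v ≡ word (⟨132⟩ a c) t → ¬ Has21 (d ∷ v) → ¬ TwoBelow u (d ∷ v) →
    IsWord (suc (3 + a + c + t)) (u ++ suc (3 + a + c + t) ∷ d ∷ v)
  insertMax-132 c t [] eq ¬21 ¬2B =
    contradiction (descent-in eq (1 ∷ʳ ++⁺ʳ _ (refl ∷ ++⁺ˡ (interval (4 + a) c) (refl ∷ minimum _)))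
                              (s≤s (s≤s (s≤s z≤n)))) ¬21
  insertMax-132 c t (x ∷ u) eq ¬21 ¬2B with ∷-injective eq
  ... | refl , eq′
    with after-descent u (B c) (trans eq′ (++-assoc (B c) A _)) (interval-≥ (3 + a) (suc c) (s≤s (s≤s (s≤s z≤n)))) ¬21
  ...   | inj₁ (refl , v≡) = insertMax-132-finalRun c t v≡ ¬2B
  ...   | inj₂ (k , refl , Q≡) =
    contradiction (twoBelow< (refl ∷ ++⁺ˡ (B c) (refl ∷ minimum k)) (here refl) ≤-refl
                     (All.lookup (All.++⁺ (interval-≥ 3 a ≤-refl) (interval-≥ (4 + a + c) t (s≤s (s≤s (s≤s z≤n)))))
                                 (∈-suffix Q≡))) ¬2B

module _ (p c : ℕ) where
  private
    E : ℕ → List ℕ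
    E e = interval (4 + p + c) (suc e)
    A = interval 1 (suc p)
    A′ = interval 2 p
    Γ = interval (3 + p) (suc c)

  insertMax-2413-finalRun : ∀ e t → d ∷ v ≡ A ++ Γ ++ interval (5 + p + c + e) t → ¬ TwoBelow (2 + p ∷ E e) (d ∷ v) →
    IsWord (suc (4 + p + c + e + t)) (2 + p ∷ E e ++ suc (4 + p + c + e + t) ∷ d ∷ v)
  insertMax-2413-finalRun e zero v≡ ¬2B =
    coreIsWord (⟨2413⟩ p c (suc e)) (sym (suc[m+n+0]≡m+suc[n] (4 + p + c) e))
      (cong (2 + p ∷_) (trans (cong (λ v → E e ++ suc (4 + p + c + e + 0) ∷ v)
                                    (trans v≡ (cong (A ++_) (++-identityʳ Γ))))
                          (interval-grow (4 + p + c) (suc e) (suc[m+n+0]≡m+suc[n] (4 + p + c) e) (A ++ Γ))))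
  insertMax-2413-finalRun e (suc t) v≡ ¬2B =
    contradiction (twoBelow< (refl ∷ refl ∷ minimum _) (∈-suffix {P = A ++ Γ} (trans v≡ (sym (++-assoc A Γ _))))
                             (m≤n⇒m≤n+o c (n≤1+n _))
                             (All.lookup (core-bounded (⟨2413⟩ p c e)) (there (here refl)))) ¬2B

  insertMax-2413 : ∀ e t u → u ++ d ∷ v ≡ word (⟨2413⟩ p c e) t → ¬ Has21 (d ∷ v) → ¬ TwoBelow u (d ∷ v) →
    IsWord (suc (4 + p + c + e + t)) (u ++ suc (4 + p + c + e + t) ∷ d ∷ v)
  insertMax-2413 e t [] eq ¬21 ¬2B =
    contradiction (descent-in eq (refl ∷ ++⁺ʳ _ (++⁺ˡ (E e) (refl ∷ minimum _))) (s≤s (s≤s z≤n))) ¬21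
  insertMax-2413 e t (y ∷ u) eq ¬21 ¬2B with ∷-injective eq
  ... | refl , eq′
    with after-descent u (E e)
           (trans eq′ (trans (++-assoc (E e) (A ++ Γ) T) (cong (λ z → E e ++ 1 ∷ z) (++-assoc A′ Γ T))))
                       (interval-≥ (4 + p + c) (suc e) (s≤s (s≤s z≤n))) ¬21
    where T = interval (5 + p + c + e) t
  ...   | inj₁ (refl , v≡) = insertMax-2413-finalRun e t v≡ ¬2B
  ...   | inj₂ (k , refl , Q≡) with suffix-meets k A′ (sym Q≡)
  ...     | d′ , d′∈v , d′∈CT =
    contradiction (twoBelow> (refl ∷ ++⁺ˡ (E e) (refl ∷ minimum k)) d′∈v (s≤s (s≤s z≤n))
                     (All.lookup (All.++⁺ (interval-≥ (3 + p) (suc c) ≤-refl) (interval-≥ (5 + p + c + e) t p+3≤))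
                                 d′∈CT)) ¬2B
    where
    p+3≤ : 3 + p ≤ 5 + p + c + e
    p+3≤ = m≤n⇒m≤n+o e (m≤n⇒m≤n+o c (≤-trans (n≤1+n _) (n≤1+n _)))

module _ (p c : ℕ) where
  private
    Γ = interval (3 + p) (suc c)
    E : ℕ → List ℕ
    E e = interval (4 + p + c) (suc e)
    A = interval 2 (suc p)

  insertMax-3142-finalRun : ∀ e t → d ∷ v ≡ A ++ interval (5 + p + c + e) t → ¬ TwoBelow (Γ ++ 1 ∷ E e) (d ∷ v) →
    IsWord (suc (4 + p + c + e + t)) ((Γ ++ 1 ∷ E e) ++ suc (4 + p + c + e + t) ∷ d ∷ v)
  insertMax-3142-finalRun e zero v≡ ¬2B =
    coreIsWord (⟨3142⟩ p c (suc e)) (sym (suc[m+n+0]≡m+suc[n] (4 + p + c) e))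
      (trans (++-assoc Γ (1 ∷ E e) _)
             (cong (λ z → Γ ++ 1 ∷ z)
                   (trans (cong (λ v → E e ++ suc (4 + p + c + e + 0) ∷ v) (trans v≡ (++-identityʳ A)))
                          (interval-grow (4 + p + c) (suc e) (suc[m+n+0]≡m+suc[n] (4 + p + c) e) A))))
  insertMax-3142-finalRun e (suc t) v≡ ¬2B =
    contradiction (twoBelow> (refl ∷ ++⁺ˡ (interval (4 + p) c) (refl ∷ minimum _)) (∈-suffix {P = A} v≡) (s≤s (s≤s z≤n))
                             (All.lookup (core-bounded (⟨3142⟩ p c e)) (here refl))) ¬2B

  insertMax-3142 : ∀ e t u → u ++ d ∷ v ≡ word (⟨3142⟩ p c e) t → ¬ Has21 (d ∷ v) → ¬ TwoBelow u (d ∷ v) →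
    IsWord (suc (4 + p + c + e + t)) (u ++ suc (4 + p + c + e + t) ∷ d ∷ v)
  insertMax-3142 e t u eq ¬21 ¬2B
    with after-descent u Γ (trans eq (trans (++-assoc Γ _ T) (cong (λ z → Γ ++ 1 ∷ z) (++-assoc (E e) A T))))
                       (interval-≥ (3 + p) (suc c) (s≤s (s≤s z≤n))) ¬21
    where T = interval (5 + p + c + e) t
  ... | inj₁ (refl , v≡) =
    contradiction (descent-in v≡ (1 ∷ʳ (refl ∷ ++⁺ˡ (interval (5 + p + c) e) (refl ∷ minimum _)))
                              (s≤s (s≤s (s≤s z≤n)))) ¬21
  ... | inj₂ (k , refl , Q≡)
    with after-descent k (E e) (sym Q≡) (interval-≥ (4 + p + c) (suc e) (s≤s (s≤s (s≤s z≤n)))) ¬21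
  ...   | inj₁ (refl , v≡) = insertMax-3142-finalRun e t v≡ ¬2B
  ...   | inj₂ (k′ , refl , Q≡′) =
    contradiction (twoBelow< (++⁺ˡ Γ (refl ∷ ++⁺ˡ (E e) (refl ∷ minimum k′))) (here refl) ≤-refl
                     (All.lookup (All.++⁺ (interval-≥ 3 p ≤-refl) (interval-≥ (5 + p + c + e) t (s≤s (s≤s (s≤s z≤n)))))
                                 (∈-suffix Q≡′))) ¬2B

insertMax-isWord : ∀ {n u v} → IsWord n (u ++ v) → ¬ Has21 v → ¬ TwoBelow u v → IsWord (suc n) (u ++ suc n ∷ v)
insertMax-isWord {u = u} {v = []} (κ , t , refl , eq) _ _ =
  κ , suc t , +-suc ∣ κ ∣ t , trans (cong (_++ _) (trans (sym (++-identityʳ u)) eq)) (word-snoc κ t)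
insertMax-isWord {v = _ ∷ _} (ι              , t , refl , eq) ¬21 ¬2B = insertMax-ι t _ eq ¬2B
insertMax-isWord {v = _ ∷ _} (⟨21⟩ a c       , t , refl , eq) ¬21 ¬2B = insertMax-21 a c t _ eq ¬21 ¬2B
insertMax-isWord {v = _ ∷ _} (⟨132⟩ a c      , t , refl , eq) ¬21 ¬2B = insertMax-132 a c t _ eq ¬21 ¬2B
insertMax-isWord {v = _ ∷ _} (⟨2413⟩ p c e   , t , refl , eq) ¬21 ¬2B = insertMax-2413 p c e t _ eq ¬21 ¬2B
insertMax-isWord {v = _ ∷ _} (⟨3142⟩ p c e   , t , refl , eq) ¬21 ¬2B = insertMax-3142 p c e t _ eq ¬21 ¬2B

avoider⇒isWord : ∀ n {w} → w ↭ interval 1 n → Avoids₀ w → IsWord n w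
avoider⇒isWord zero p _ with ↭-empty-inv p
... | refl = ι , 0 , refl , refl
avoider⇒isWord (suc n) p avoids with perm-removeMax p
... | u , v , refl , p′ with Equivalence.to (insertMax⇔ (perm-bounded p′)) avoids
...   | avoids′ , ¬21 , ¬2B = insertMax-isWord (avoider⇒isWord n p′ avoids′) ¬21 ¬2B


-- Distinct shapes give distinct words

-- The maximal runs of consecutive values of a list, each recorded as (first value, length).
prependRun : ℕ → List (ℕ × ℕ) → List (ℕ × ℕ)
prependRun x []             = (x , 1) ∷ []
prependRun x ((s , l) ∷ rs) with suc x ≟ s
... | yes _ = (x , suc l) ∷ rs
... | no _  = (x , 1) ∷ (s , l) ∷ rs

runs : List ℕ → List (ℕ × ℕ)
runs []       = []
runs (x ∷ xs) = prependRun x (runs xs)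

prependRun-starts : ∀ x rs → ∃₂ λ l rs′ → prependRun x rs ≡ (x , l) ∷ rs′
prependRun-starts x []             = 1 , [] , refl
prependRun-starts x ((s , l) ∷ rs) with suc x ≟ s
... | yes _ = suc l , rs , refl
... | no _  = 1 , (s , l) ∷ rs , refl

prependRun-grow : prependRun x ((suc x , l) ∷ rs) ≡ (x , suc l) ∷ rs
prependRun-grow {x} with suc x ≟ suc x
... | yes _ = refl
... | no ≢  = contradiction refl ≢

prependRun-new : ∀ x y ys → y ≢ suc x → runs (x ∷ y ∷ ys) ≡ (x , 1) ∷ runs (y ∷ ys)
prependRun-new x y ys y≢ with runs (y ∷ ys) | prependRun-starts y (runs ys)
... | _ | l , rs , refl with suc x ≟ y
...   | yes eq = contradiction (sym eq) y≢
...   | no _   = refl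

runs-interval : ∀ s l rest → head rest ≢ just (s + suc l) →
  runs (interval s (suc l) ++ rest) ≡ (s , suc l) ∷ runs rest
runs-interval s zero [] _ = refl
runs-interval s zero (y ∷ ys) y≢ = prependRun-new s y ys (λ eq → y≢ (cong just (trans eq (+-comm 1 s))))
runs-interval s (suc l) rest ≢end =
  trans (cong (prependRun s) (runs-interval (suc s) l rest (λ eq → ≢end (trans eq (cong just (sym (+-suc s (suc l))))))))
        prependRun-grow

runs-interval-last : ∀ s l → runs (interval s (suc l)) ≡ [ (s , suc l) ]
runs-interval-last s l = trans (cong runs (sym (++-identityʳ (interval s (suc l))))) (runs-interval s l [] (λ ()))

just-≢ : ∀ {m y} → m < y → just y ≢ just m
just-≢ m<y eq = <⇒≢ m<y (sym (just-injective eq))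

coreRuns : Core → List (ℕ × ℕ)
coreRuns ι              = []
coreRuns (⟨21⟩ a c)     = (2 + a , suc c) ∷ (1 , suc a) ∷ []
coreRuns (⟨132⟩ a c)    = (1 , 1) ∷ (3 + a , suc c) ∷ (2 , suc a) ∷ []
coreRuns (⟨2413⟩ p c e) = (2 + p , 1) ∷ (4 + p + c , suc e) ∷ (1 , suc p) ∷ (3 + p , suc c) ∷ []
coreRuns (⟨3142⟩ p c e) = (3 + p , suc c) ∷ (1 , 1) ∷ (4 + p + c , suc e) ∷ (2 , suc p) ∷ []

-- Appending the next value makes the final run visible even when t = 0.
runs-word : ∀ κ t → runs (word κ (suc t)) ≡ coreRuns κ ++ [ (suc ∣ κ ∣ , suc t) ]
runs-word ι t = runs-interval-last 1 t
runs-word (⟨21⟩ a c) t =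
  trans (cong runs (++-assoc B A T))
  (trans (runs-interval (2 + a) c (A ++ T) (λ ()))
  (cong (_ ∷_) (trans (runs-interval 1 a T (just-≢ (m≤m+n (3 + a) c)))
  (cong (_ ∷_) (runs-interval-last (3 + a + c) t)))))
  where
  B = interval (2 + a) (suc c)
  A = interval 1 (suc a)
  T = interval (3 + a + c) (suc t)
runs-word (⟨132⟩ a c) t =
  trans (prependRun-new 1 (3 + a) ((interval (4 + a) c ++ A) ++ T) (λ ()))
  (cong (_ ∷_) (trans (cong runs (++-assoc B A T))
  (trans (runs-interval (3 + a) c (A ++ T) (λ ()))
  (cong (_ ∷_) (trans (runs-interval 2 a T (just-≢ (m≤m+n (4 + a) c)))
  (cong (_ ∷_) (runs-interval-last (4 + a + c) t)))))))
  where
  B = interval (3 + a) (suc c)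
  A = interval 2 (suc a)
  T = interval (4 + a + c) (suc t)
runs-word (⟨2413⟩ p c e) t =
  trans (prependRun-new (2 + p) (4 + p + c) ((interval (5 + p + c) e ++ A ++ Γ) ++ T)
                        (λ eq → <⇒≢ (m≤m+n (4 + p) c) (sym eq)))
  (cong (_ ∷_) (trans (cong runs (trans (++-assoc E (A ++ Γ) T) (cong (E ++_) (++-assoc A Γ T))))
  (trans (runs-interval (4 + p + c) e (A ++ Γ ++ T) (λ ()))
  (cong (_ ∷_) (trans (runs-interval 1 p (Γ ++ T) (just-≢ ≤-refl))
  (cong (_ ∷_) (trans (runs-interval (3 + p) c T (just-≢ Γ<T))
  (cong (_ ∷_) (runs-interval-last (5 + p + c + e) t)))))))))
  where
  E = interval (4 + p + c) (suc e)
  A = interval 1 (suc p)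
  Γ = interval (3 + p) (suc c)
  T = interval (5 + p + c + e) (suc t)
  Γ<T : 3 + p + suc c < 5 + p + c + e
  Γ<T = s≤s (s≤s (s≤s (s≤s (≤-trans (≤-reflexive (+-suc p c)) (s≤s (m≤m+n (p + c) e))))))
runs-word (⟨3142⟩ p c e) t =
  trans (cong runs (trans (++-assoc Γ _ T) (cong (λ w → Γ ++ 1 ∷ w) (++-assoc E A T))))
  (trans (runs-interval (3 + p) c (1 ∷ E ++ A ++ T) (λ ()))
  (cong (_ ∷_) (trans (prependRun-new 1 (4 + p + c) (interval (5 + p + c) e ++ A ++ T) (λ ()))
  (cong (_ ∷_) (trans (runs-interval (4 + p + c) e (A ++ T) (λ ()))
  (cong (_ ∷_) (trans (runs-interval 2 p T (just-≢ (m≤n⇒m≤n+o e (m≤n⇒m≤n+o c (n≤1+n (4 + p))))))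
  (cong (_ ∷_) (runs-interval-last (5 + p + c + e) t)))))))))
  where
  Γ = interval (3 + p) (suc c)
  E = interval (4 + p + c) (suc e)
  A = interval 2 (suc p)
  T = interval (5 + p + c + e) (suc t)

coreRuns-injective : ∀ κ κ′ {s s′ t t′} →
  coreRuns κ ++ [ (s , suc t) ] ≡ coreRuns κ′ ++ [ (s′ , suc t′) ] → κ ≡ κ′ × t ≡ t′
coreRuns-injective ι              ι              refl = refl , refl
coreRuns-injective (⟨21⟩ a c)     (⟨21⟩ a c)     refl = refl , refl
coreRuns-injective (⟨132⟩ a c)    (⟨132⟩ a c)    refl = refl , refl
coreRuns-injective (⟨2413⟩ p c e) (⟨2413⟩ p c e) refl = refl , refl
coreRuns-injective (⟨3142⟩ p c e) (⟨3142⟩ p c e) refl = refl , refl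

length-word : ∀ κ t → length (word κ t) ≡ ∣ κ ∣ + t
length-word κ t = trans (↭-length (proj₁ (isWord⇒avoider _ (κ , t , refl , refl)))) (length-interval 1 _)

word-next : ∀ κ t → word κ t ++ [ suc (length (word κ t)) ] ≡ word κ (suc t)
word-next κ t = trans (cong (λ n → word κ t ++ [ suc n ]) (length-word κ t)) (word-snoc κ t)

word-injective : ∀ {κ κ′ t t′} → word κ t ≡ word κ′ t′ → κ ≡ κ′ × t ≡ t′
word-injective {κ} {κ′} {t} {t′} eq = coreRuns-injective κ κ′ (begin
  coreRuns κ ++ [ (suc ∣ κ ∣ , suc t) ]     ≡⟨ runs-word κ t ⟨
  runs (word κ (suc t))                      ≡⟨ cong runs (word-next κ t) ⟨
  runs (next (word κ t))                     ≡⟨ cong (λ w → runs (next w)) eq ⟩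
  runs (next (word κ′ t′))                   ≡⟨ cong runs (word-next κ′ t′) ⟩
  runs (word κ′ (suc t′))                    ≡⟨ runs-word κ′ t′ ⟩
  coreRuns κ′ ++ [ (suc ∣ κ′ ∣ , suc t′) ]  ∎)
  where
  open ≡-Reasoning
  next : List ℕ → List ℕ
  next w = w ++ [ suc (length w) ]


-- Enumerating the shapes

incHead : Vec ℕ (suc k) → Vec ℕ (suc k)
incHead (x ∷ xs) = suc x ∷ xs

compositions : (k m : ℕ) → List (Vec ℕ k)
compositions zero    zero    = [ [] ]
compositions zero    (suc m) = []
compositions (suc k) zero    = map (0 ∷_) (compositions k zero)
compositions (suc k) (suc m) = map (0 ∷_) (compositions k (suc m)) ++ map incHead (compositions (suc k) m)

∈-compositions⁺ : (xs : Vec ℕ k) → xs ∈ compositions k (Vec.sum xs)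
∈-compositions⁺ [] = here refl
∈-compositions⁺ (zero ∷ xs) with Vec.sum xs | ∈-compositions⁺ xs
... | zero  | xs∈ = ∈-map⁺ (0 ∷_) xs∈
... | suc _ | xs∈ = ∈-++⁺ˡ (∈-map⁺ (0 ∷_) xs∈)
∈-compositions⁺ (suc x ∷ xs) = ∈-++⁺ʳ _ (∈-map⁺ incHead (∈-compositions⁺ (x ∷ xs)))

∈-compositions⁻ : ∀ k m {xs} → xs ∈ compositions k m → Vec.sum xs ≡ m
∈-compositions⁻ zero    zero    (here refl) = refl
∈-compositions⁻ (suc k) zero    xs∈ with ∈-map⁻ (0 ∷_) xs∈
... | ys , ys∈ , refl = ∈-compositions⁻ k zero ys∈
∈-compositions⁻ (suc k) (suc m) xs∈ with ∈-++⁻ (map (0 ∷_) (compositions k (suc m))) xs∈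
... | inj₁ xs∈₀ with ∈-map⁻ (0 ∷_) xs∈₀
...   | ys , ys∈ , refl = ∈-compositions⁻ k (suc m) ys∈
∈-compositions⁻ (suc k) (suc m) xs∈ | inj₂ xs∈₁ with ∈-map⁻ incHead xs∈₁
...   | y ∷ ys , ys∈ , refl = cong suc (∈-compositions⁻ (suc k) m ys∈)

∈-compositions : ∀ {xs : Vec ℕ k} → Vec.sum xs ≡ m → xs ∈ compositions k m
∈-compositions {xs = xs} refl = ∈-compositions⁺ xs

compositions-unique : ∀ k m → Unique (compositions k m)
compositions-unique zero    zero    = [] ∷ []
compositions-unique zero    (suc m) = []
compositions-unique (suc k) zero    = Unique.map⁺ (λ { refl → refl }) (compositions-unique k zero)
compositions-unique (suc k) (suc m) =
  Unique.++⁺ (Unique.map⁺ (λ { refl → refl }) (compositions-unique k (suc m)))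
      (Unique.map⁺ incHead-injective (compositions-unique (suc k) m))
      starts-apart
  where
  incHead-injective : ∀ {xs ys : Vec ℕ (suc k)} → incHead xs ≡ incHead ys → xs ≡ ys
  incHead-injective {_ ∷ _} {_ ∷ _} refl = refl
  starts-apart : Disjoint (map (0 ∷_) (compositions k (suc m))) (map incHead (compositions (suc k) m))
  starts-apart (xs∈₀ , xs∈₁) with ∈-map⁻ (0 ∷_) xs∈₀ | ∈-map⁻ incHead xs∈₁
  ... | _ , _ , refl | _ ∷ _ , _ , ()

length-compositions : ∀ k m → length (compositions (suc k) m) ≡ (m + k) C k
length-compositions zero    zero    = refl
length-compositions zero    (suc m) = trans (length-map incHead (compositions 1 m)) (length-compositions zero m)
length-compositions (suc k) zero    =
  trans (length-map (0 ∷_) (compositions (suc k) zero))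
        (trans (length-compositions k zero) (trans (nCn≡1 k) (sym (nCn≡1 (suc k)))))
length-compositions (suc k) (suc m) = begin
  length (map (0 ∷_) (compositions (suc k) (suc m)) ++ map incHead (compositions (suc (suc k)) m))
    ≡⟨ length-++ (map (0 ∷_) (compositions (suc k) (suc m))) ⟩
  length (map (0 ∷_) (compositions (suc k) (suc m))) + length (map incHead (compositions (suc (suc k)) m))
    ≡⟨ cong₂ _+_ (length-map (0 ∷_) (compositions (suc k) (suc m))) (length-map incHead (compositions (suc (suc k)) m)) ⟩
  length (compositions (suc k) (suc m)) + length (compositions (suc (suc k)) m)
    ≡⟨ cong₂ _+_ (length-compositions k (suc m)) (length-compositions (suc k) m) ⟩
  (suc m + k) C k + (m + suc k) C suc k
    ≡⟨ cong (λ n → n C k + (m + suc k) C suc k) (sym (+-suc m k)) ⟩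
  (m + suc k) C k + (m + suc k) C suc k
    ≡⟨ nCk+nC[k+1]≡[n+1]C[k+1] (m + suc k) k ⟩
  suc (m + suc k) C suc k ∎
  where open ≡-Reasoning

shifted : ∀ {A : Set} → ℕ → (ℕ → List A) → ℕ → List A
shifted zero    f n       = f n
shifted (suc s) f zero    = []
shifted (suc s) f (suc n) = shifted s f n

∈-shifted⁻ : ∀ {A : Set} s (f : ℕ → List A) n {x} → x ∈ shifted s f n → ∃ λ m → n ≡ s + m × x ∈ f m
∈-shifted⁻ zero    f n       x∈ = n , refl , x∈
∈-shifted⁻ (suc s) f (suc n) x∈ with ∈-shifted⁻ s f n x∈
... | m , refl , x∈′ = m , refl , x∈′

shifted-unique : ∀ {A : Set} s (f : ℕ → List A) n → (∀ m → Unique (f m)) → Unique (shifted s f n)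
shifted-unique zero    f n       f-unique = f-unique n
shifted-unique (suc s) f zero    f-unique = []
shifted-unique (suc s) f (suc n) f-unique = shifted-unique s f n f-unique

as21 as132 : Vec ℕ 3 → Core × ℕ
as21  (a ∷ c ∷ t ∷ []) = ⟨21⟩ a c , t
as132 (a ∷ c ∷ t ∷ []) = ⟨132⟩ a c , t

as2413 as3142 : Vec ℕ 4 → Core × ℕ
as2413 (p ∷ c ∷ e ∷ t ∷ []) = ⟨2413⟩ p c e , t
as3142 (p ∷ c ∷ e ∷ t ∷ []) = ⟨3142⟩ p c e , t

kind : Core → Fin 5
kind ι              = zero
kind (⟨21⟩ _ _)     = suc zero
kind (⟨132⟩ _ _)    = suc (suc zero)
kind (⟨2413⟩ _ _ _) = suc (suc (suc zero))
kind (⟨3142⟩ _ _ _) = suc (suc (suc (suc zero)))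

-- The parameters of the shapes (κ , t) of each kind and size n form the weak compositions of n
-- minus the number of runs of κ.
family : Fin 5 → ℕ → List (Core × ℕ)
family zero                          n = [ (ι , n) ]
family (suc zero)                      = shifted 2 (λ m → map as21 (compositions 3 m))
family (suc (suc zero))                = shifted 3 (λ m → map as132 (compositions 3 m))
family (suc (suc (suc zero)))          = shifted 4 (λ m → map as2413 (compositions 4 m))
family (suc (suc (suc (suc zero))))    = shifted 4 (λ m → map as3142 (compositions 4 m))

size : Core × ℕ → ℕ
size (κ , t) = ∣ κ ∣ + t

sum-3 : ∀ a c t → a + c + t ≡ Vec.sum (a ∷ c ∷ t ∷ [])
sum-3 a c t = trans (+-assoc a c t) (cong (λ z → a + (c + z)) (sym (+-identityʳ t)))

sum-4 : ∀ p c e t → p + c + e + t ≡ Vec.sum (p ∷ c ∷ e ∷ t ∷ [])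
sum-4 p c e t =
  trans (+-assoc (p + c) e t) (trans (+-assoc p c (e + t)) (cong (λ z → p + (c + (e + z))) (sym (+-identityʳ t))))

module _ {k} (s : ℕ) (f : Vec ℕ k → Core × ℕ) (i : Fin 5)
         (kind-f : ∀ xs → kind (proj₁ (f xs)) ≡ i) (size-f : ∀ xs → size (f xs) ≡ s + Vec.sum xs) where

  compositionFamily-sound : ∀ n {x} → x ∈ shifted s (λ m → map f (compositions k m)) n →
    kind (proj₁ x) ≡ i × size x ≡ n
  compositionFamily-sound n x∈ with ∈-shifted⁻ s _ n x∈
  ... | m , refl , x∈′ with ∈-map⁻ f x∈′
  ...   | xs , xs∈ , refl = kind-f xs , trans (size-f xs) (cong (_+_ s) (∈-compositions⁻ k m xs∈))

family-sound : ∀ i n {x} → x ∈ family i n → kind (proj₁ x) ≡ i × size x ≡ n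
family-sound zero                       n (here refl) = refl , refl
family-sound (suc zero)                 n x∈ =
  compositionFamily-sound 2 as21 _ (λ { (_ ∷ _ ∷ _ ∷ []) → refl }) (λ { (a ∷ c ∷ t ∷ []) → cong (_+_ 2) (sum-3 a c t) })
    n x∈
family-sound (suc (suc zero))           n x∈ =
  compositionFamily-sound 3 as132 _ (λ { (_ ∷ _ ∷ _ ∷ []) → refl }) (λ { (a ∷ c ∷ t ∷ []) → cong (_+_ 3) (sum-3 a c t) })
    n x∈
family-sound (suc (suc (suc zero)))     n x∈ =
  compositionFamily-sound 4 as2413 _ (λ { (_ ∷ _ ∷ _ ∷ _ ∷ []) → refl }) (λ { (p ∷ c ∷ e ∷ t ∷ []) → cong (_+_ 4) (sum-4 p c e t) })
    n x∈
family-sound (suc (suc (suc (suc zero)))) n x∈ =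
  compositionFamily-sound 4 as3142 _ (λ { (_ ∷ _ ∷ _ ∷ _ ∷ []) → refl }) (λ { (p ∷ c ∷ e ∷ t ∷ []) → cong (_+_ 4) (sum-4 p c e t) })
    n x∈

family-complete : ∀ κ t → (κ , t) ∈ family (kind κ) (size (κ , t))
family-complete ι              t = here refl
family-complete (⟨21⟩ a c)     t = ∈-map⁺ as21 (∈-compositions (sym (sum-3 a c t)))
family-complete (⟨132⟩ a c)    t = ∈-map⁺ as132 (∈-compositions (sym (sum-3 a c t)))
family-complete (⟨2413⟩ p c e) t = ∈-map⁺ as2413 (∈-compositions (sym (sum-4 p c e t)))
family-complete (⟨3142⟩ p c e) t = ∈-map⁺ as3142 (∈-compositions (sym (sum-4 p c e t)))

family-unique : ∀ i n → Unique (family i n)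
family-unique zero                         n = [] ∷ []
family-unique (suc zero)                   n = shifted-unique 2 _ n (λ m → Unique.map⁺ injective (compositions-unique 3 m))
  where
  injective : ∀ {xs ys} → as21 xs ≡ as21 ys → xs ≡ ys
  injective {_ ∷ _ ∷ _ ∷ []} {_ ∷ _ ∷ _ ∷ []} refl = refl
family-unique (suc (suc zero))             n = shifted-unique 3 _ n (λ m → Unique.map⁺ injective (compositions-unique 3 m))
  where
  injective : ∀ {xs ys} → as132 xs ≡ as132 ys → xs ≡ ys
  injective {_ ∷ _ ∷ _ ∷ []} {_ ∷ _ ∷ _ ∷ []} refl = refl
family-unique (suc (suc (suc zero)))       n = shifted-unique 4 _ n (λ m → Unique.map⁺ injective (compositions-unique 4 m))
  where
  injective : ∀ {xs ys} → as2413 xs ≡ as2413 ys → xs ≡ ys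
  injective {_ ∷ _ ∷ _ ∷ _ ∷ []} {_ ∷ _ ∷ _ ∷ _ ∷ []} refl = refl
family-unique (suc (suc (suc (suc zero)))) n = shifted-unique 4 _ n (λ m → Unique.map⁺ injective (compositions-unique 4 m))
  where
  injective : ∀ {xs ys} → as3142 xs ≡ as3142 ys → xs ≡ ys
  injective {_ ∷ _ ∷ _ ∷ _ ∷ []} {_ ∷ _ ∷ _ ∷ _ ∷ []} refl = refl

family-apart : ∀ n i j → i ≢ j → Disjoint (family i n) (family j n)
family-apart n i j i≢j (x∈i , x∈j) = i≢j (trans (sym (proj₁ (family-sound i n x∈i))) (proj₁ (family-sound j n x∈j)))

shapes : ℕ → List (Core × ℕ)
shapes n = concatMap (λ i → family i n) (allFin 5)

shapes-unique : ∀ n → Unique (shapes n)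
shapes-unique n =
  Unique.concat⁺ (All.map⁺ {f = fam} (All.tabulate {xs = allFin 5} (λ {i} _ → family-unique i n)))
          (AllPairs.map⁺ {f = fam} (AllPairs.map (λ {i} {j} → family-apart n i j) (Unique.allFin⁺ 5)))
  where
  fam = λ i → family i n

∈-shapes⇔ : ∀ {n κ t} → (κ , t) ∈ shapes n ⇔ ∣ κ ∣ + t ≡ n
∈-shapes⇔ {n} {κ} {t} = mk⇔ to from
  where
  to : (κ , t) ∈ shapes n → ∣ κ ∣ + t ≡ n
  to x∈ with satisfied (∈-concatMap⁻ (λ i → family i n) {xs = allFin 5} x∈)
  ... | i , x∈i = proj₂ (family-sound i n x∈i)
  from : ∣ κ ∣ + t ≡ n → (κ , t) ∈ shapes n
  from refl = ∈-concat⁺′ (family-complete κ t) (∈-map⁺ (λ i → family i (∣ κ ∣ + t)) (∈-allFin (kind κ)))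


-- Counting

avoiders : ℕ → List (List ℕ)
avoiders n = map (uncurry word) (shapes n)

avoiders-enumerate : ∀ n → Enumerates n R₀ (avoiders n)
avoiders-enumerate n = Unique.map⁺ uncurry-word-injective (shapes-unique n) , λ w → mk⇔ (to w) (from w)
  where
  uncurry-word-injective : ∀ {x y : Core × ℕ} → uncurry word x ≡ uncurry word y → x ≡ y
  uncurry-word-injective {κ , t} {κ′ , t′} eq with word-injective {κ} {κ′} {t} {t′} eq
  ... | refl , refl = refl

  upTo≡interval : applyUpTo suc n ≡ interval 1 n
  upTo≡interval = applyUpTo≡interval suc 1 n (λ _ → refl)

  to : ∀ w → w ∈ avoiders n → InS n R₀ w
  to w w∈ with ∈-map⁻ (uncurry word) w∈
  ... | (κ , t) , x∈ , refl with isWord⇒avoider n (κ , t , Equivalence.to (∈-shapes⇔ {κ = κ} {t = t}) x∈ , refl)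
  ...   | perm , avoids = subst (word κ t ↭_) (sym upTo≡interval) perm , Equivalence.from avoids-R₀⇔ avoids

  from : ∀ w → InS n R₀ w → w ∈ avoiders n
  from w (perm , avoids) with avoider⇒isWord n (subst (w ↭_) upTo≡interval perm) (Equivalence.to avoids-R₀⇔ avoids)
  ... | κ , t , size≡ , refl = ∈-map⁺ (uncurry word) (Equivalence.from (∈-shapes⇔ {κ = κ} {t = t}) size≡)

length-compositionFamily : ∀ {k} (f : Vec ℕ (suc k) → Core × ℕ) m →
  length (map f (compositions (suc k) m)) ≡ (k + m) C k
length-compositionFamily {k} f m =
  trans (length-map f (compositions (suc k) m)) (trans (length-compositions k m) (cong (_C k) (+-comm m k)))

length-family₂₁ : ∀ N → length (family (suc zero) (suc N)) ≡ suc N C 2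
length-family₂₁ zero    = refl
length-family₂₁ (suc N) = length-compositionFamily as21 N

length-family₁₃₂ : ∀ N → length (family (suc (suc zero)) (suc N)) ≡ N C 2
length-family₁₃₂ zero          = refl
length-family₁₃₂ (suc zero)    = refl
length-family₁₃₂ (suc (suc N)) = length-compositionFamily as132 N

length-family₄ : ∀ (f : Vec ℕ 4 → Core × ℕ) N → length (shifted 4 (λ m → map f (compositions 4 m)) (suc N)) ≡ N C 3
length-family₄ f zero                = refl
length-family₄ f (suc zero)          = refl
length-family₄ f (suc (suc zero))    = refl
length-family₄ f (suc (suc (suc N))) = length-compositionFamily f N

length-concat : ∀ {A : Set} (xss : List (List A)) → length (concat xss) ≡ sum (map length xss)
length-concat []         = refl
length-concat (xs ∷ xss) = trans (length-++ xs) (cong (_+_ (length xs)) (length-concat xss))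

length-avoiders : ∀ N → length (avoiders (suc N)) ≡ N C 0 + N C 1 + 2 * (N C 2) + 2 * (N C 3)
length-avoiders N = begin
  length (avoiders (suc N))
    ≡⟨ length-map (uncurry word) (shapes (suc N)) ⟩
  length (shapes (suc N))
    ≡⟨ length-concat (map (λ i → family i (suc N)) (allFin 5)) ⟩
  1 + (length (family (suc zero) (suc N)) + (length (family (suc (suc zero)) (suc N))
      + (length (family (suc (suc (suc zero))) (suc N)) + (length (family (suc (suc (suc (suc zero)))) (suc N)) + 0))))
    ≡⟨ cong suc (cong₂ _+_ (length-family₂₁ N) (cong₂ _+_ (length-family₁₃₂ N)
                 (cong₂ _+_ (length-family₄ as2413 N) (cong (_+ 0) (length-family₄ as3142 N))))) ⟩
  1 + (suc N C 2 + (N C 2 + (N C 3 + (N C 3 + 0))))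
    ≡⟨ cong (λ x → 1 + (x + (N C 2 + (N C 3 + (N C 3 + 0))))) (sym (nCk+nC[k+1]≡[n+1]C[k+1] N 1)) ⟩
  1 + ((N C 1 + N C 2) + (N C 2 + (N C 3 + (N C 3 + 0))))
    ≡⟨ collect (N C 1) (N C 2) (N C 3) ⟩
  N C 0 + N C 1 + 2 * (N C 2) + 2 * (N C 3) ∎
  where
  open ≡-Reasoning
  collect : ∀ x y z → 1 + ((x + y) + (y + (z + (z + 0)))) ≡ 1 + x + 2 * y + 2 * z
  collect = solve-∀


-- The generating function

sumTo-zero : ∀ k (h : ℕ → ℤ) → (∀ i → i ≤ k → h i ≡ + 0) → sumTo k h ≡ + 0
sumTo-zero zero    h h≡0 = h≡0 0 z≤n
sumTo-zero (suc k) h h≡0 = cong₂ ℤ._+_ (sumTo-zero k h (λ i i≤k → h≡0 i (m≤n⇒m≤1+n i≤k))) (h≡0 (suc k) ≤-refl)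

sumTo-vanishing : ∀ m (h : ℕ → ℤ) → (∀ j → h (suc (m + j)) ≡ + 0) → ∀ k → sumTo (m + k) h ≡ sumTo m h
sumTo-vanishing m h h≡0 zero    = cong (λ n → sumTo n h) (+-identityʳ m)
sumTo-vanishing m h h≡0 (suc k) =
  trans (cong (λ n → sumTo n h) (+-suc m k))
        (trans (cong₂ ℤ._+_ (sumTo-vanishing m h h≡0 k) (h≡0 k)) (ℤ.+-identityʳ (sumTo m h)))

suc-∸-gap : ∀ {i n} → i < n → ∃ λ j → suc n ∸ i ≡ suc (suc j)
suc-∸-gap {zero}  {suc n} _         = n , refl
suc-∸-gap {suc i} {suc n} (s≤s i<n) = suc-∸-gap i<n

⊗-oneMinusX-vanishing : ∀ (f : Series) d → (∀ j → f (d + j) ≡ + 0) → ∀ j → (f ⊗ oneMinusX) (suc (d + j)) ≡ + 0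
⊗-oneMinusX-vanishing f d f≡0 j =
  cong₂ ℤ._+_ (sumTo-zero (d + j) _ term≡0) (cong (λ y → y ℤ.* oneMinusX (suc (d + j) ∸ suc (d + j))) f[1+d+j]≡0)
  where
  f[1+d+j]≡0 : f (suc (d + j)) ≡ + 0
  f[1+d+j]≡0 = trans (cong f (sym (+-suc d j))) (f≡0 (suc j))
  term≡0 : ∀ i → i ≤ d + j → f i ℤ.* oneMinusX (suc (d + j) ∸ i) ≡ + 0
  term≡0 i i≤ with m≤n⇒m<n∨m≡n i≤
  ... | inj₂ refl = trans (cong (λ n → f i ℤ.* oneMinusX n) (m+n∸n≡m 1 i)) (cong (λ y → y ℤ.* oneMinusX 1) (f≡0 j))
  ... | inj₁ i< with suc-∸-gap i<
  ...   | k , eq = trans (cong (λ n → f i ℤ.* oneMinusX n) eq) (ℤ.*-zeroʳ (f i))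

oneMinusX⁴ : Series
oneMinusX⁴ = oneMinusX ⊗ oneMinusX ⊗ oneMinusX ⊗ oneMinusX

oneMinusX⁴-vanishing : ∀ j → oneMinusX⁴ (5 + j) ≡ + 0
oneMinusX⁴-vanishing =
  ⊗-oneMinusX-vanishing (oneMinusX ⊗ oneMinusX ⊗ oneMinusX) 4
    (⊗-oneMinusX-vanishing (oneMinusX ⊗ oneMinusX) 3 (⊗-oneMinusX-vanishing oneMinusX 2 (λ _ → refl)))

numerator : Series
numerator = X ⊗ poly (+ 1 ∷ - (+ 2) ∷ + 3 ∷ [])

numerator-vanishing : ∀ j → numerator (4 + j) ≡ + 0
numerator-vanishing j = sumTo-zero (4 + j) _ term≡0
  where
  term≡0 : ∀ i → i ≤ 4 + j → X i ℤ.* poly (+ 1 ∷ - (+ 2) ∷ + 3 ∷ []) (4 + j ∸ i) ≡ + 0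
  term≡0 zero          _ = refl
  term≡0 (suc zero)    _ = refl
  term≡0 (suc (suc _)) _ = refl

Coefficients : Set
Coefficients = ℕ × ℕ × ℕ × ℕ

binomialSum : Coefficients → ℕ → ℕ
binomialSum (α , β , γ , δ) N = α * (N C 0) + β * (N C 1) + γ * (N C 2) + δ * (N C 3)

pascalStep : Coefficients → Coefficients
pascalStep (α , β , γ , δ) = α + β , β + γ , γ + δ , δ

pascalSteps : ℕ → Coefficients → Coefficients
pascalSteps zero    c = c
pascalSteps (suc m) c = pascalSteps m (pascalStep c)

binomialSum-suc : ∀ c N → binomialSum c (suc N) ≡ binomialSum (pascalStep c) N
binomialSum-suc (α , β , γ , δ) N
  rewrite sym (nCk+nC[k+1]≡[n+1]C[k+1] N 0) | sym (nCk+nC[k+1]≡[n+1]C[k+1] N 1) | sym (nCk+nC[k+1]≡[n+1]C[k+1] N 2) =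
  regroup α β γ δ (N C 0) (N C 1) (N C 2) (N C 3)
  where
  regroup : ∀ α β γ δ x₀ x₁ x₂ x₃ →
    α * x₀ + β * (x₀ + x₁) + γ * (x₁ + x₂) + δ * (x₂ + x₃) ≡ (α + β) * x₀ + (β + γ) * x₁ + (γ + δ) * x₂ + δ * x₃
  regroup = solve-∀

binomialSum-+ : ∀ m c N → binomialSum c (m + N) ≡ binomialSum (pascalSteps m c) N
binomialSum-+ zero    c N = refl
binomialSum-+ (suc m) c N = trans (binomialSum-suc c (m + N)) (binomialSum-+ m (pascalStep c) N)

countCoefficients : Coefficients
countCoefficients = 1 , 1 , 2 , 2

count-fourthDifference : ∀ k →
  binomialSum countCoefficients (4 + k) + 6 * binomialSum countCoefficients (2 + k) + binomialSum countCoefficients k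
    ≡ 4 * binomialSum countCoefficients (3 + k) + 4 * binomialSum countCoefficients (1 + k)
count-fourthDifference k = begin
  count (4 + k) + 6 * count (2 + k) + count k
    ≡⟨ cong₂ (λ x y → x + 6 * y + count k) (binomialSum-+ 4 countCoefficients k) (binomialSum-+ 2 countCoefficients k) ⟩
  binomialSum (25 , 21 , 10 , 2) k + 6 * binomialSum (5 , 7 , 6 , 2) k + count k
    ≡⟨ identity (k C 0) (k C 1) (k C 2) (k C 3) ⟩
  4 * binomialSum (12 , 13 , 8 , 2) k + 4 * binomialSum (2 , 3 , 4 , 2) k
    ≡⟨ cong₂ (λ x y → 4 * x + 4 * y) (binomialSum-+ 3 countCoefficients k) (binomialSum-+ 1 countCoefficients k) ⟨
  4 * count (3 + k) + 4 * count (1 + k) ∎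
  where
  open ≡-Reasoning
  count = binomialSum countCoefficients
  identity : ∀ x₀ x₁ x₂ x₃ →
    25 * x₀ + 21 * x₁ + 10 * x₂ + 2 * x₃ + 6 * (5 * x₀ + 7 * x₁ + 6 * x₂ + 2 * x₃) + (1 * x₀ + 1 * x₁ + 2 * x₂ + 2 * x₃)
      ≡ 4 * (12 * x₀ + 13 * x₁ + 8 * x₂ + 2 * x₃) + 4 * (2 * x₀ + 3 * x₁ + 4 * x₂ + 2 * x₃)
  identity = solve-∀

fourthDifference-ℤ : ∀ a₅ a₄ a₃ a₂ a₁ → a₅ + 6 * a₃ + a₁ ≡ 4 * a₄ + 4 * a₂ →
  + 1 ℤ.* + a₅ ℤ.+ - (+ 4) ℤ.* + a₄ ℤ.+ + 6 ℤ.* + a₃ ℤ.+ - (+ 4) ℤ.* + a₂ ℤ.+ + 1 ℤ.* + a₁ ≡ + 0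
fourthDifference-ℤ a₅ a₄ a₃ a₂ a₁ eq = begin
  + 1 ℤ.* + a₅ ℤ.+ - (+ 4) ℤ.* + a₄ ℤ.+ + 6 ℤ.* + a₃ ℤ.+ - (+ 4) ℤ.* + a₂ ℤ.+ + 1 ℤ.* + a₁
    ≡⟨ regroup (+ a₅) (+ a₄) (+ a₃) (+ a₂) (+ a₁) ⟩
  (+ a₅ ℤ.+ + 6 ℤ.* + a₃ ℤ.+ + a₁) ℤ.- (+ 4 ℤ.* + a₄ ℤ.+ + 4 ℤ.* + a₂)
    ≡⟨ cong₂ ℤ._-_ positive positive′ ⟨
  + (a₅ + 6 * a₃ + a₁) ℤ.- + (4 * a₄ + 4 * a₂)
    ≡⟨ cong (λ x → + x ℤ.- + (4 * a₄ + 4 * a₂)) eq ⟩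
  + (4 * a₄ + 4 * a₂) ℤ.- + (4 * a₄ + 4 * a₂)
    ≡⟨ ℤ.+-inverseʳ (+ (4 * a₄ + 4 * a₂)) ⟩
  + 0 ∎
  where
  open ≡-Reasoning
  regroup : ∀ a b c d e →
    + 1 ℤ.* a ℤ.+ - (+ 4) ℤ.* b ℤ.+ + 6 ℤ.* c ℤ.+ - (+ 4) ℤ.* d ℤ.+ + 1 ℤ.* e
      ≡ (a ℤ.+ + 6 ℤ.* c ℤ.+ e) ℤ.- (+ 4 ℤ.* b ℤ.+ + 4 ℤ.* d)
  regroup = ℤ-Solver.solve-∀
  positive : + (a₅ + 6 * a₃ + a₁) ≡ + a₅ ℤ.+ + 6 ℤ.* + a₃ ℤ.+ + a₁
  positive =
    trans (ℤ.pos-+ (a₅ + 6 * a₃) a₁) (cong (ℤ._+ + a₁) (trans (ℤ.pos-+ a₅ (6 * a₃)) (cong (λ x → + a₅ ℤ.+ x) (ℤ.pos-* 6 a₃))))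
  positive′ : + (4 * a₄ + 4 * a₂) ≡ + 4 ℤ.* + a₄ ℤ.+ + 4 ℤ.* + a₂
  positive′ = trans (ℤ.pos-+ (4 * a₄) (4 * a₂)) (cong₂ ℤ._+_ (ℤ.pos-* 4 a₄) (ℤ.pos-* 4 a₂))

length-avoiders-binomialSum : ∀ N → length (avoiders (suc N)) ≡ binomialSum countCoefficients N
length-avoiders-binomialSum N =
  trans (length-avoiders N)
        (sym (cong₂ (λ x y → x + y + 2 * (N C 2) + 2 * (N C 3)) (*-identityˡ (N C 0)) (*-identityˡ (N C 1))))

length-fourthDifference : ∀ k →
  length (avoiders (5 + k)) + 6 * length (avoiders (3 + k)) + length (avoiders (1 + k))
    ≡ 4 * length (avoiders (4 + k)) + 4 * length (avoiders (2 + k))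
length-fourthDifference k = begin
  ℓ (5 + k) + 6 * ℓ (3 + k) + ℓ (1 + k)
    ≡⟨ cong₂ _+_ (cong₂ (λ x y → x + 6 * y) (L (4 + k)) (L (2 + k))) (L k) ⟩
  count (4 + k) + 6 * count (2 + k) + count k
    ≡⟨ count-fourthDifference k ⟩
  4 * count (3 + k) + 4 * count (1 + k)
    ≡⟨ cong₂ (λ x y → 4 * x + 4 * y) (L (3 + k)) (L (1 + k)) ⟨
  4 * ℓ (4 + k) + 4 * ℓ (2 + k) ∎
  where
  open ≡-Reasoning
  ℓ : ℕ → ℕ
  ℓ m = length (avoiders m)
  count = binomialSum countCoefficients
  L = length-avoiders-binomialSum

generatingFunction : ∀ n → (oneMinusX⁴ ⊗ (λ m → + length (avoiders m))) n ≡ (oneMinusX⁴ ⊕ numerator) n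
generatingFunction 0 = refl
generatingFunction 1 = refl
generatingFunction 2 = refl
generatingFunction 3 = refl
generatingFunction 4 = refl
generatingFunction (suc (suc (suc (suc (suc k))))) = begin
  (oneMinusX⁴ ⊗ counts) (5 + k)
    ≡⟨ sumTo-vanishing 4 h (λ j → cong (λ y → y ℤ.* counts (5 + k ∸ (5 + j))) (oneMinusX⁴-vanishing j)) (suc k) ⟩
  sumTo 4 h
    ≡⟨ fourthDifference-ℤ (ℓ (5 + k)) (ℓ (4 + k)) (ℓ (3 + k)) (ℓ (2 + k)) (ℓ (1 + k)) (length-fourthDifference k) ⟩
  + 0
    ≡⟨ cong₂ ℤ._+_ (oneMinusX⁴-vanishing k) (numerator-vanishing (suc k)) ⟨
  (oneMinusX⁴ ⊕ numerator) (5 + k) ∎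
  where
  open ≡-Reasoning
  ℓ : ℕ → ℕ
  ℓ m = length (avoiders m)
  counts : Series
  counts m = + ℓ m
  h : ℕ → ℤ
  h i = oneMinusX⁴ i ℤ.* counts (5 + k ∸ i)


proposition7p4 : Σ (ℕ → List (List ℕ)) λ L →
      ((n : ℕ) → Enumerates n R₀ (L n))
    × ((n : ℕ) → n ≥ 1 →
        length (L n) ≡ (n ∸ 1) C 0 + (n ∸ 1) C 1 + 2 * ((n ∸ 1) C 2) + 2 * ((n ∸ 1) C 3))
    × ((n : ℕ) →
        ((oneMinusX ⊗ oneMinusX ⊗ oneMinusX ⊗ oneMinusX) ⊗ (λ m → + length (L m))) n
          ≡ ((oneMinusX ⊗ oneMinusX ⊗ oneMinusX ⊗ oneMinusX)
              ⊕ (X ⊗ poly (+ 1 ∷ - (+ 2) ∷ + 3 ∷ []))) n)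
proposition7p4 = avoiders , avoiders-enumerate , count , generatingFunction
  where
  count : (n : ℕ) → n ≥ 1 → length (avoiders n) ≡ (n ∸ 1) C 0 + (n ∸ 1) C 1 + 2 * ((n ∸ 1) C 2) + 2 * ((n ∸ 1) C 3)
  count (suc N) _ = length-avoiders N
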